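{- For every set of sentences $\Gamma$ and every sentence $A$ of $\mathcal{L}_Q$: $\Gamma\vdash_iA$ if and only if $\Gamma\models_iA$.
   Context: $\mathcal{L}_Q$: first-order language with $\bot,{\sim},\land,\lor,\to,\forall,\exists$, a countable set $\mathsf{Con}$ of constants, variables, predicate symbols; $\neg A:=A\to\bot$, $A\leftrightarrow B:=(A\to B)\land(B\to A)$. $\mathbf{QBDi}$ is the Hilbert system with axioms (Ax1) $A\to(B\to A)$; (Ax2) $(A\to(B\to C))\to((A\to B)\to(A\to C))$; (Ax4) $(A\land B)\to A$; (Ax5) $(A\land B)\to B$; (Ax6) $(C\to A)\to((C\to B)\to(C\to(A\land B)))$; (Ax7) $A\to(A\lor B)$; (Ax8) $B\to(A\lor B)$; (Ax9) $(A\to C)\to((B\to C)\to((A\lor B)\to C))$; (Ax10) $\bot\to A$; (Ax11) $A(t)\to\exists xA$; (Ax12) $\forall x(A(x)\to B)\to(\exists xA(x)\to B)$ ($x$ not free in $B$); (Ax13) $\forall x(B\to A)\to(B\to\forall xA)$ ($x$ not free in $B$); (Ax14) $\forall xA\to A(t)$; (Ax15) $A\to{\sim}\bot$; (Ax16) ${\sim}{\sim}A\leftrightarrow A$; (Ax17) ${\sim}(A\land B)\leftrightarrow({\sim}A\lor{\sim}B)$; (Ax18) ${\sim}(A\lor B)\leftrightarrow({\sim}A\land{\sim}B)$; (Ax19) ${\sim}(A\to B)\leftrightarrow(\neg{\sim}A\land{\sim}B)$; (Ax20) ${\sim}\forall xA\leftrightarrow\exists x{\sim}A$; (Ax21) ${\sim}\exists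 xA\leftrightarrow\forall x{\sim}A$; rules MP (from $A$, $A\to B$ infer $B$) and Gen (from $A$ infer $\forall xA$). $\Gamma\vdash_iA$: a finite list ending in $A$ each item of which is in $\Gamma$, an axiom instance, or follows from earlier items by MP or Gen. A $\mathbf{QBDi}$-model is $\langle W,\le,D,V\rangle$: $W$ nonempty, $\le$ a partial order on $W$; $D(w)\supseteq\mathsf{Con}$ with $D(w)\subseteq D(x)$ for $w\le x$; for each $n$-ary predicate $P$ and $w$, $V^+(w,P),V^-(w,P)\subseteq D(w)^n$, both monotone along $\le$ (no disjointness required). $I(w,A)\subseteq\{0,1\}$ for sentences with parameters from $D(w)$: $1\in I(w,P(\vec d))$ iff $\vec d\in V^+(w,P)$; $0\in I(w,P(\vec d))$ iff $\vec d\in V^-(w,P)$; $1\notin I(w,\bot)$, $0\in I(w,\bot)$; $1\in I(w,{\sim}A)$ iff $0\in I(w,A)$; $0\in I(w,{\sim}A)$ iff $1\in I(w,A)$; $1\in I(w,A\land B)$ iff $1\in I(w,A)$ and $1\in I(w,B)$; $0\in I(w,A\land B)$ iff $0\in I(w,A)$ or $0\in I(w,B)$; $1\in I(w,A\lor B)$ iff $1\in I(w,A)$ or $1\in I(w,B)$; $0\in I(w,A\lor B)$ iff $0\in I(w,A)$ and $0\in I(w,B)$; $1\in I(w,A\to B)$ iff for all $x\ge w$, $1\notin I(x,A)$ or $1\in I(x,B)$; $0\in I(w,A\to B)$ iff ($0\notin I(x,A)$ for all $x\ge w$) and $0\in I(w,B)$; $1\in I(w,\forall xA)$ iff for all $x\ge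 w$ and $d\in D(x)$, $1\in I(x,A(d))$; $0\in I(w,\forall xA)$ iff $0\in I(w,A(d))$ for some $d\in D(w)$; $1\in I(w,\exists xA)$ iff $1\in I(w,A(d))$ for some $d\in D(w)$; $0\in I(w,\exists xA)$ iff for all $x\ge w$ and $d\in D(x)$, $0\in I(x,A(d))$. $\Gamma\models_iA$ iff for every $\mathbf{QBDi}$-model and every $w$, if $1\in I(w,B)$ for all $B\in\Gamma$ then $1\in I(w,A)$. -}

module Defs where

open import Data.Nat using (ℕ; _≡ᵇ_)
open import Data.Bool using (Bool; true; false; if_then_else_; _∨_; _∧_; not)
open import Data.Vec using (Vec; []; _∷_)
import Data.Vec as Vec
open import Data.Vec.Relation.Unary.All using (All)
open import Data.Empty using (⊥)
open import Data.Unit using (⊤)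
open import Data.Product using (Σ; _×_; _,_)
open import Data.Sum using (_⊎_; inj₁)
open import Relation.Nullary using (¬_)
open import Relation.Binary.PropositionalEquality using (_≡_)
open import Function.Bundles using (_⇔_)

-- Predicate symbols: for each arity n a countable family indexed by ℕ;
-- the atomic formula  pred n k ts  is the k-th n-ary predicate applied to ts.

Var : Set
Var = ℕ

Con : Set
Con = ℕ

data Term : Set where
  var : Var → Term
  con : Con → Term

infixr 6 _∧ᶠ_
infixr 5 _∨ᶠ_
infixr 4 _⇒_
infix 3 _⇔ᶠ_
infix 7 ∼_

data Form : Set where
  pred  : (n : ℕ) → ℕ → Vec Term n → Form
  ⊥ᶠ    : Form
  ∼_    : Form → Form
  _∧ᶠ_  : Form → Form → Form
  _∨ᶠ_  : Form → Form → Form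
  _⇒_   : Form → Form → Form
  ∀ᶠ    : Var → Form → Form
  ∃ᶠ    : Var → Form → Form

¬ᶠ_ : Form → Form
¬ᶠ A = A ⇒ ⊥ᶠ

_⇔ᶠ_ : Form → Form → Form
A ⇔ᶠ B = (A ⇒ B) ∧ᶠ (B ⇒ A)

occT : Var → Term → Bool
occT x (var y) = x ≡ᵇ y
occT x (con c) = false

occTs : ∀ {n} → Var → Vec Term n → Bool
occTs x []       = false
occTs x (t ∷ ts) = occT x t ∨ occTs x ts

occursFree : Var → Form → Bool
occursFree x (pred n k ts) = occTs x ts
occursFree x ⊥ᶠ        = false
occursFree x (∼ A)     = occursFree x A
occursFree x (A ∧ᶠ B)  = occursFree x A ∨ occursFree x B
occursFree x (A ∨ᶠ B)  = occursFree x A ∨ occursFree x B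
occursFree x (A ⇒ B)   = occursFree x A ∨ occursFree x B
occursFree x (∀ᶠ y A)  = if x ≡ᵇ y then false else occursFree x A
occursFree x (∃ᶠ y A)  = if x ≡ᵇ y then false else occursFree x A

NotFree : Var → Form → Set
NotFree x A = occursFree x A ≡ false

Sentence : Form → Set
Sentence A = ∀ x → NotFree x A

subT : Term → Var → Term → Term
subT t x (var y) = if x ≡ᵇ y then t else var y
subT t x (con c) = con c

subTs : ∀ {n} → Term → Var → Vec Term n → Vec Term n
subTs t x []       = []
subTs t x (u ∷ us) = subT t x u ∷ subTs t x us

sub : Term → Var → Form → Form
sub t x (pred n k ts) = pred n k (subTs t x ts)
sub t x ⊥ᶠ       = ⊥ᶠ
sub t x (∼ A)    = ∼ sub t x A
sub t x (A ∧ᶠ B) = sub t x A ∧ᶠ sub t x B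
sub t x (A ∨ᶠ B) = sub t x A ∨ᶠ sub t x B
sub t x (A ⇒ B)  = sub t x A ⇒ sub t x B
sub t x (∀ᶠ y A) = if x ≡ᵇ y then ∀ᶠ y A else ∀ᶠ y (sub t x A)
sub t x (∃ᶠ y A) = if x ≡ᵇ y then ∃ᶠ y A else ∃ᶠ y (sub t x A)

freeFor : Term → Var → Form → Bool
freeFor t x (pred n k ts) = true
freeFor t x ⊥ᶠ       = true
freeFor t x (∼ A)    = freeFor t x A
freeFor t x (A ∧ᶠ B) = freeFor t x A ∧ freeFor t x B
freeFor t x (A ∨ᶠ B) = freeFor t x A ∧ freeFor t x B
freeFor t x (A ⇒ B)  = freeFor t x A ∧ freeFor t x B
freeFor t x (∀ᶠ y A) = not (occursFree x (∀ᶠ y A)) ∨ (not (occT y t) ∧ freeFor t x A)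
freeFor t x (∃ᶠ y A) = not (occursFree x (∃ᶠ y A)) ∨ (not (occT y t) ∧ freeFor t x A)

data Axiom : Form → Set where
  ax1  : ∀ A B → Axiom (A ⇒ (B ⇒ A))
  ax2  : ∀ A B C → Axiom ((A ⇒ (B ⇒ C)) ⇒ ((A ⇒ B) ⇒ (A ⇒ C)))
  ax4  : ∀ A B → Axiom ((A ∧ᶠ B) ⇒ A)
  ax5  : ∀ A B → Axiom ((A ∧ᶠ B) ⇒ B)
  ax6  : ∀ A B C → Axiom ((C ⇒ A) ⇒ ((C ⇒ B) ⇒ (C ⇒ (A ∧ᶠ B))))
  ax7  : ∀ A B → Axiom (A ⇒ (A ∨ᶠ B))
  ax8  : ∀ A B → Axiom (B ⇒ (A ∨ᶠ B))
  ax9  : ∀ A B C → Axiom ((A ⇒ C) ⇒ ((B ⇒ C) ⇒ ((A ∨ᶠ B) ⇒ C)))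
  ax10 : ∀ A → Axiom (⊥ᶠ ⇒ A)
  ax11 : ∀ A x t → freeFor t x A ≡ true → Axiom (sub t x A ⇒ ∃ᶠ x A)
  ax12 : ∀ A B x → NotFree x B → Axiom (∀ᶠ x (A ⇒ B) ⇒ (∃ᶠ x A ⇒ B))
  ax13 : ∀ A B x → NotFree x B → Axiom (∀ᶠ x (B ⇒ A) ⇒ (B ⇒ ∀ᶠ x A))
  ax14 : ∀ A x t → freeFor t x A ≡ true → Axiom (∀ᶠ x A ⇒ sub t x A)
  ax15 : ∀ A → Axiom (A ⇒ ∼ ⊥ᶠ)
  ax16 : ∀ A → Axiom (∼ ∼ A ⇔ᶠ A)
  ax17 : ∀ A B → Axiom (∼ (A ∧ᶠ B) ⇔ᶠ (∼ A ∨ᶠ ∼ B))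
  ax18 : ∀ A B → Axiom (∼ (A ∨ᶠ B) ⇔ᶠ (∼ A ∧ᶠ ∼ B))
  ax19 : ∀ A B → Axiom (∼ (A ⇒ B) ⇔ᶠ (¬ᶠ (∼ A) ∧ᶠ ∼ B))
  ax20 : ∀ A x → Axiom (∼ ∀ᶠ x A ⇔ᶠ ∃ᶠ x (∼ A))
  ax21 : ∀ A x → Axiom (∼ ∃ᶠ x A ⇔ᶠ ∀ᶠ x (∼ A))

infix 2 _⊢ᵢ_

-- Γ ⊢ᵢ A : derivations (as trees; equivalent to finite lists) from Γ
data _⊢ᵢ_ (Γ : Form → Set) : Form → Set where
  hyp : ∀ {A} → Γ A → Γ ⊢ᵢ A
  ax  : ∀ {A} → Axiom A → Γ ⊢ᵢ A
  mp  : ∀ {A B} → Γ ⊢ᵢ A → Γ ⊢ᵢ (A ⇒ B) → Γ ⊢ᵢ B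
  gen : ∀ {A} x → Γ ⊢ᵢ A → Γ ⊢ᵢ ∀ᶠ x A

record Model : Set₁ where
  field
    W      : Set
    _≤_    : W → W → Set
    ≤-refl    : ∀ {w} → w ≤ w
    ≤-trans   : ∀ {w x y} → w ≤ x → x ≤ y → w ≤ y
    ≤-antisym : ∀ {w x} → w ≤ x → x ≤ w → w ≡ x
    -- elements are constants (so Con ⊆ D(w)) or further objects from E
    E      : Set
    D      : W → (Con ⊎ E) → Set
    D-con  : ∀ w c → D w (inj₁ c)
    D-mono : ∀ {w x d} → w ≤ x → D w d → D x d
    -- V⁺ w n k / V⁻ w n k : extension / anti-extension of the k-th n-ary predicate
    V⁺ V⁻  : W → (n : ℕ) → ℕ → Vec (Con ⊎ E) n → Set
    V⁺-dom  : ∀ {w n k ds} → V⁺ w n k ds → All (D w) ds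
    V⁻-dom  : ∀ {w n k ds} → V⁻ w n k ds → All (D w) ds
    V⁺-mono : ∀ {w x n k ds} → w ≤ x → V⁺ w n k ds → V⁺ x n k ds
    V⁻-mono : ∀ {w x n k ds} → w ≤ x → V⁻ w n k ds → V⁻ x n k ds

module _ (M : Model) where
  open Model M

  Elem : Set
  Elem = Con ⊎ E

  upd : (Var → Elem) → Var → Elem → Var → Elem
  upd ρ y d z = if z ≡ᵇ y then d else ρ z

  evalT : (Var → Elem) → Term → Elem
  evalT ρ (var x) = ρ x
  evalT ρ (con c) = inj₁ c

  -- I⁺ w ρ A  means  1 ∈ I(w, A),  I⁻ w ρ A  means  0 ∈ I(w, A),
  -- where the free variables of A are read as the parameters ρ(x)
  -- (so ∀/∃ clauses with A(d) become updates ρ[y ↦ d]).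
  I⁺ I⁻ : W → (Var → Elem) → Form → Set
  I⁺ w ρ (pred n k ts) = V⁺ w n k (Vec.map (evalT ρ) ts)
  I⁺ w ρ ⊥ᶠ       = ⊥
  I⁺ w ρ (∼ A)    = I⁻ w ρ A
  I⁺ w ρ (A ∧ᶠ B) = I⁺ w ρ A × I⁺ w ρ B
  I⁺ w ρ (A ∨ᶠ B) = I⁺ w ρ A ⊎ I⁺ w ρ B
  I⁺ w ρ (A ⇒ B)  = ∀ x → w ≤ x → ¬ I⁺ x ρ A ⊎ I⁺ x ρ B
  I⁺ w ρ (∀ᶠ y A) = ∀ x → w ≤ x → ∀ d → D x d → I⁺ x (upd ρ y d) A
  I⁺ w ρ (∃ᶠ y A) = Σ Elem λ d → D w d × I⁺ w (upd ρ y d) A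
  I⁻ w ρ (pred n k ts) = V⁻ w n k (Vec.map (evalT ρ) ts)
  I⁻ w ρ ⊥ᶠ       = ⊤
  I⁻ w ρ (∼ A)    = I⁺ w ρ A
  I⁻ w ρ (A ∧ᶠ B) = I⁻ w ρ A ⊎ I⁻ w ρ B
  I⁻ w ρ (A ∨ᶠ B) = I⁻ w ρ A × I⁻ w ρ B
  I⁻ w ρ (A ⇒ B)  = (∀ x → w ≤ x → ¬ I⁻ x ρ A) × I⁻ w ρ B
  I⁻ w ρ (∀ᶠ y A) = Σ Elem λ d → D w d × I⁻ w (upd ρ y d) A
  I⁻ w ρ (∃ᶠ y A) = ∀ x → w ≤ x → ∀ d → D x d → I⁻ x (upd ρ y d) A

  -- truth of a sentence at w (the assignment is irrelevant for sentences;
  -- we use the constant assignment to the constant 0)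
  true⁺ : W → Form → Set
  true⁺ w A = I⁺ w (λ _ → inj₁ 0) A

infix 2 _⊨ᵢ_

_⊨ᵢ_ : (Form → Set) → Form → Set₁
Γ ⊨ᵢ A = ∀ (M : Model) (w : Model.W M) →
  (∀ B → Γ B → true⁺ M w B) → true⁺ M w A

-- Soundness: every axiom holds at every world of every model, and modus ponens and generalisation
-- preserve truth; sentential hypotheses may be used at any later world and under any environment
-- because truth is monotone and depends only on the free variables.
--
-- Completeness is a Henkin construction. The constants of Γ are renamed to even numbers, so the odd
-- ones can serve as witnesses; they are stratified into levels, so every theory built so far misses
-- infinitely many of them. A Lindenbaum lemma extends Δ with Δ, B ⊬ C to a prime, deductively closed,
-- witnessed theory containing B but not C. The canonical worlds are finite chains of such extensions,
-- and the truth lemma reads truth of B as membership of B and falsity of B as membership of ∼B,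
-- axioms 16–21 mirroring the falsity clauses of the semantics.

module Submission where

open import Level using (0ℓ)
open import Axiom.ExcludedMiddle using (ExcludedMiddle)
open import Function using (_∘_; id)
open import Function.Bundles using (_⇔_; mk⇔; Equivalence)
open import Function.Construct.Identity using (⇔-id)
open import Function.Construct.Symmetry using (⇔-sym)
open import Function.Construct.Composition using () renaming (equivalence to ⇔-trans)
open import Function.Related.TypeIsomorphisms using (¬-cong-⇔)
open import Data.Nat using (ℕ; zero; suc; _≡ᵇ_; _≤_; _<_; _⊔_; _+_; s≤s; z≤n; _≤′_; ≤′-reflexive; ≤′-step)
open import Data.Nat.Properties
  using (≤-refl; ≤-trans; <-irrefl; m≤m⊔n; m≤n⊔m; m⊔n≤o⇒m≤o; m⊔n≤o⇒n≤o; m≤n⇒m≤1+n; n≤1+n;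
         +-suc; +-identityʳ; m≤m+n; m≤n+m; +-monoˡ-≤; ≤⇒≤′)
open import Data.Bool using (true; false; if_then_else_; _∨_; _∧_; not)
open import Data.Bool.Properties using (∨-conicalˡ; ∨-conicalʳ; ∧-conicalˡ; ∧-conicalʳ; ∨-zeroʳ)
open import Data.List using (List; []; _∷_; _++_; length)
open import Data.List.Properties using (++-assoc; length-++-≤ʳ)
open import Data.Vec using (Vec; []; _∷_)
import Data.Vec as Vec
open import Data.Vec.Relation.Unary.All using (All; []; _∷_)
import Data.Vec.Relation.Unary.All as All
open import Data.Product using (Σ; _×_; _,_; proj₁; proj₂)
open import Data.Product.Function.NonDependent.Propositional using (_×-⇔_)
open import Data.Sum using (_⊎_; inj₁; inj₂; [_,_]) renaming (map to ⊎-map)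
open import Data.Sum.Function.Propositional using (_⊎-⇔_)
open import Data.Unit using (⊤; tt)
open import Data.Empty using (⊥-elim)
open import Relation.Nullary using (¬_; Dec; yes; no)
open import Relation.Unary using (Pred; _⊆_; _∪_; ｛_｝)
open import Relation.Binary.PropositionalEquality using (_≡_; _≢_; refl; sym; trans; cong; cong₂; subst)

open import Defs

open Equivalence using (to; from)

≡ᵇ-refl : ∀ n → (n ≡ᵇ n) ≡ true
≡ᵇ-refl zero    = refl
≡ᵇ-refl (suc n) = ≡ᵇ-refl n

≡ᵇ-sym : ∀ m n → (m ≡ᵇ n) ≡ (n ≡ᵇ m)
≡ᵇ-sym zero    zero    = refl
≡ᵇ-sym zero    (suc n) = refl
≡ᵇ-sym (suc m) zero    = refl
≡ᵇ-sym (suc m) (suc n) = ≡ᵇ-sym m n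

≡ᵇ-true⇒≡ : ∀ m n → (m ≡ᵇ n) ≡ true → m ≡ n
≡ᵇ-true⇒≡ zero    zero    _ = refl
≡ᵇ-true⇒≡ (suc m) (suc n) e = cong suc (≡ᵇ-true⇒≡ m n e)

≢⇒≡ᵇ-false : ∀ m n → m ≢ n → (m ≡ᵇ n) ≡ false
≢⇒≡ᵇ-false zero    zero    m≢n = ⊥-elim (m≢n refl)
≢⇒≡ᵇ-false zero    (suc n) _   = refl
≢⇒≡ᵇ-false (suc m) zero    _   = refl
≢⇒≡ᵇ-false (suc m) (suc n) m≢n = ≢⇒≡ᵇ-false m n (m≢n ∘ cong suc)

<⇒≡ᵇ-false : ∀ {m n} → n < m → (m ≡ᵇ n) ≡ false
<⇒≡ᵇ-false {m} {n} n<m = ≢⇒≡ᵇ-false m n λ { refl → <-irrefl refl n<m }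

∨-trueˡ : ∀ {a} b → a ≡ true → a ∨ b ≡ true
∨-trueˡ b refl = refl

∨-trueʳ : ∀ a {b} → b ≡ true → a ∨ b ≡ true
∨-trueʳ true  _ = refl
∨-trueʳ false e = e

¬⊎⇔→ : ExcludedMiddle 0ℓ → ∀ {P Q : Set} → (¬ P ⊎ Q) ⇔ (P → Q)
¬⊎⇔→ em {P} = mk⇔ (λ { (inj₁ ¬p) p → ⊥-elim (¬p p) ; (inj₂ q) _ → q }) from-→
  where
  from-→ : ∀ {Q} → (P → Q) → ¬ P ⊎ Q
  from-→ f with em {P}
  ... | yes p = inj₂ (f p)
  ... | no ¬p = inj₁ ¬p

subT-notOcc : ∀ t x u → occT x u ≡ false → subT t x u ≡ u
subT-notOcc t x (var y) e rewrite e = refl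
subT-notOcc t x (con c) e = refl

subTs-notOcc : ∀ {n} t x (us : Vec Term n) → occTs x us ≡ false → subTs t x us ≡ us
subTs-notOcc t x []       e = refl
subTs-notOcc t x (u ∷ us) e =
  cong₂ _∷_ (subT-notOcc t x u (∨-conicalˡ _ _ e)) (subTs-notOcc t x us (∨-conicalʳ _ _ e))

sub-notFree : ∀ t x A → NotFree x A → sub t x A ≡ A
sub-notFree t x (pred n k ts) e = cong (pred n k) (subTs-notOcc t x ts e)
sub-notFree t x ⊥ᶠ       e = refl
sub-notFree t x (∼ A)    e = cong ∼_ (sub-notFree t x A e)
sub-notFree t x (A ∧ᶠ B) e = cong₂ _∧ᶠ_ (sub-notFree t x A (∨-conicalˡ _ _ e)) (sub-notFree t x B (∨-conicalʳ _ _ e))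
sub-notFree t x (A ∨ᶠ B) e = cong₂ _∨ᶠ_ (sub-notFree t x A (∨-conicalˡ _ _ e)) (sub-notFree t x B (∨-conicalʳ _ _ e))
sub-notFree t x (A ⇒ B)  e = cong₂ _⇒_ (sub-notFree t x A (∨-conicalˡ _ _ e)) (sub-notFree t x B (∨-conicalʳ _ _ e))
sub-notFree t x (∀ᶠ y A) e with x ≡ᵇ y
... | true  = refl
... | false = cong (∀ᶠ y) (sub-notFree t x A e)
sub-notFree t x (∃ᶠ y A) e with x ≡ᵇ y
... | true  = refl
... | false = cong (∃ᶠ y) (sub-notFree t x A e)

notOcc-subT : ∀ t x v u → occT v t ≡ false → occT v u ≡ false → occT v (subT t x u) ≡ false
notOcc-subT t x v (var y) vt vu with x ≡ᵇ y
... | true  = vt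
... | false = vu
notOcc-subT t x v (con c) vt vu = refl

notOcc-subTs : ∀ {n} t x v (us : Vec Term n) → occT v t ≡ false → occTs v us ≡ false →
               occTs v (subTs t x us) ≡ false
notOcc-subTs t x v []       vt vu = refl
notOcc-subTs t x v (u ∷ us) vt vu =
  cong₂ _∨_ (notOcc-subT t x v u vt (∨-conicalˡ _ _ vu)) (notOcc-subTs t x v us vt (∨-conicalʳ _ _ vu))

notFree-sub : ∀ t x v A → occT v t ≡ false → NotFree v A → NotFree v (sub t x A)
notFree-sub t x v (pred n k ts) vt vA = notOcc-subTs t x v ts vt vA
notFree-sub t x v ⊥ᶠ       vt vA = refl
notFree-sub t x v (∼ A)    vt vA = notFree-sub t x v A vt vA
notFree-sub t x v (A ∧ᶠ B) vt vA =
  cong₂ _∨_ (notFree-sub t x v A vt (∨-conicalˡ _ _ vA)) (notFree-sub t x v B vt (∨-conicalʳ _ _ vA))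
notFree-sub t x v (A ∨ᶠ B) vt vA =
  cong₂ _∨_ (notFree-sub t x v A vt (∨-conicalˡ _ _ vA)) (notFree-sub t x v B vt (∨-conicalʳ _ _ vA))
notFree-sub t x v (A ⇒ B)  vt vA =
  cong₂ _∨_ (notFree-sub t x v A vt (∨-conicalˡ _ _ vA)) (notFree-sub t x v B vt (∨-conicalʳ _ _ vA))
notFree-sub t x v (∀ᶠ y A) vt vA with x ≡ᵇ y
... | true  = vA
... | false with v ≡ᵇ y
...   | true  = refl
...   | false = notFree-sub t x v A vt vA
notFree-sub t x v (∃ᶠ y A) vt vA with x ≡ᵇ y
... | true  = vA
... | false with v ≡ᵇ y
...   | true  = refl
...   | false = notFree-sub t x v A vt vA

notOcc-subT-con : ∀ c x u → occT x (subT (con c) x u) ≡ false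
notOcc-subT-con c x (var y) with x ≡ᵇ y in e
... | true  = refl
... | false = e
notOcc-subT-con c x (con c') = refl

notOcc-subTs-con : ∀ {n} c x (us : Vec Term n) → occTs x (subTs (con c) x us) ≡ false
notOcc-subTs-con c x []       = refl
notOcc-subTs-con c x (u ∷ us) = cong₂ _∨_ (notOcc-subT-con c x u) (notOcc-subTs-con c x us)

notFree-sub-con : ∀ c x A → NotFree x (sub (con c) x A)
notFree-sub-con c x (pred n k ts) = notOcc-subTs-con c x ts
notFree-sub-con c x ⊥ᶠ       = refl
notFree-sub-con c x (∼ A)    = notFree-sub-con c x A
notFree-sub-con c x (A ∧ᶠ B) = cong₂ _∨_ (notFree-sub-con c x A) (notFree-sub-con c x B)
notFree-sub-con c x (A ∨ᶠ B) = cong₂ _∨_ (notFree-sub-con c x A) (notFree-sub-con c x B)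
notFree-sub-con c x (A ⇒ B)  = cong₂ _∨_ (notFree-sub-con c x A) (notFree-sub-con c x B)
notFree-sub-con c x (∀ᶠ y A) with x ≡ᵇ y in e
... | true  rewrite e = refl
... | false rewrite e = notFree-sub-con c x A
notFree-sub-con c x (∃ᶠ y A) with x ≡ᵇ y in e
... | true  rewrite e = refl
... | false rewrite e = notFree-sub-con c x A

sentence-closed : ∀ {B} → Sentence B → ∀ v → occursFree v B ≢ true
sentence-closed s v e with () ← trans (sym e) (s v)

-- Sentence (∀ᶠ x A) and Sentence (∃ᶠ x A) unfold to the same type.
sentence-sub-con : ∀ c x A → Sentence (∀ᶠ x A) → Sentence (sub (con c) x A)
sentence-sub-con c x A s v with v ≡ᵇ x in e
... | true  rewrite ≡ᵇ-true⇒≡ v x e = notFree-sub-con c x A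
... | false = notFree-sub (con c) x v A refl (subst (λ b → (if b then false else occursFree v A) ≡ false) e (s v))

freeFor-con : ∀ c x A → freeFor (con c) x A ≡ true
freeFor-con c x (pred n k ts) = refl
freeFor-con c x ⊥ᶠ       = refl
freeFor-con c x (∼ A)    = freeFor-con c x A
freeFor-con c x (A ∧ᶠ B) = cong₂ _∧_ (freeFor-con c x A) (freeFor-con c x B)
freeFor-con c x (A ∨ᶠ B) = cong₂ _∧_ (freeFor-con c x A) (freeFor-con c x B)
freeFor-con c x (A ⇒ B)  = cong₂ _∧_ (freeFor-con c x A) (freeFor-con c x B)
freeFor-con c x (∀ᶠ y A) rewrite freeFor-con c x A = ∨-zeroʳ _
freeFor-con c x (∃ᶠ y A) rewrite freeFor-con c x A = ∨-zeroʳ _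

varBoundT : Term → ℕ
varBoundT (var x) = suc x
varBoundT (con c) = 0

varBoundTs : ∀ {n} → Vec Term n → ℕ
varBoundTs []       = 0
varBoundTs (u ∷ us) = varBoundT u ⊔ varBoundTs us

varBound : Form → ℕ
varBound (pred n k ts) = varBoundTs ts
varBound ⊥ᶠ       = 0
varBound (∼ A)    = varBound A
varBound (A ∧ᶠ B) = varBound A ⊔ varBound B
varBound (A ∨ᶠ B) = varBound A ⊔ varBound B
varBound (A ⇒ B)  = varBound A ⊔ varBound B
varBound (∀ᶠ y A) = suc y ⊔ varBound A
varBound (∃ᶠ y A) = suc y ⊔ varBound A

notOcc-varBoundT : ∀ z u → varBoundT u ≤ z → occT z u ≡ false
notOcc-varBoundT z (var x) le = <⇒≡ᵇ-false le
notOcc-varBoundT z (con c) le = refl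

notOcc-varBoundTs : ∀ {n} z (us : Vec Term n) → varBoundTs us ≤ z → occTs z us ≡ false
notOcc-varBoundTs z []       le = refl
notOcc-varBoundTs z (u ∷ us) le =
  cong₂ _∨_ (notOcc-varBoundT z u (m⊔n≤o⇒m≤o _ _ le)) (notOcc-varBoundTs z us (m⊔n≤o⇒n≤o _ _ le))

notFree-varBound : ∀ z A → varBound A ≤ z → NotFree z A
notFree-varBound z (pred n k ts) le = notOcc-varBoundTs z ts le
notFree-varBound z ⊥ᶠ       le = refl
notFree-varBound z (∼ A)    le = notFree-varBound z A le
notFree-varBound z (A ∧ᶠ B) le =
  cong₂ _∨_ (notFree-varBound z A (m⊔n≤o⇒m≤o _ _ le)) (notFree-varBound z B (m⊔n≤o⇒n≤o _ _ le))
notFree-varBound z (A ∨ᶠ B) le =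
  cong₂ _∨_ (notFree-varBound z A (m⊔n≤o⇒m≤o _ _ le)) (notFree-varBound z B (m⊔n≤o⇒n≤o _ _ le))
notFree-varBound z (A ⇒ B)  le =
  cong₂ _∨_ (notFree-varBound z A (m⊔n≤o⇒m≤o _ _ le)) (notFree-varBound z B (m⊔n≤o⇒n≤o _ _ le))
notFree-varBound z (∀ᶠ y A) le with z ≡ᵇ y
... | true  = refl
... | false = notFree-varBound z A (m⊔n≤o⇒n≤o _ _ le)
notFree-varBound z (∃ᶠ y A) le with z ≡ᵇ y
... | true  = refl
... | false = notFree-varBound z A (m⊔n≤o⇒n≤o _ _ le)

subT-rename-back : ∀ x z u → varBoundT u ≤ z → subT (var x) z (subT (var z) x u) ≡ u
subT-rename-back x z (var y) le with x ≡ᵇ y in e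
... | true  rewrite ≡ᵇ-refl z = cong var (≡ᵇ-true⇒≡ x y e)
... | false rewrite <⇒≡ᵇ-false {z} {y} le = refl
subT-rename-back x z (con c) le = refl

subTs-rename-back : ∀ {n} x z (us : Vec Term n) → varBoundTs us ≤ z →
                    subTs (var x) z (subTs (var z) x us) ≡ us
subTs-rename-back x z []       le = refl
subTs-rename-back x z (u ∷ us) le =
  cong₂ _∷_ (subT-rename-back x z u (m⊔n≤o⇒m≤o _ _ le)) (subTs-rename-back x z us (m⊔n≤o⇒n≤o _ _ le))

sub-rename-back : ∀ x z A → varBound A ≤ z → sub (var x) z (sub (var z) x A) ≡ A
sub-rename-back x z (pred n k ts) le = cong (pred n k) (subTs-rename-back x z ts le)
sub-rename-back x z ⊥ᶠ       le = refl
sub-rename-back x z (∼ A)    le = cong ∼_ (sub-rename-back x z A le)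
sub-rename-back x z (A ∧ᶠ B) le =
  cong₂ _∧ᶠ_ (sub-rename-back x z A (m⊔n≤o⇒m≤o _ _ le)) (sub-rename-back x z B (m⊔n≤o⇒n≤o _ _ le))
sub-rename-back x z (A ∨ᶠ B) le =
  cong₂ _∨ᶠ_ (sub-rename-back x z A (m⊔n≤o⇒m≤o _ _ le)) (sub-rename-back x z B (m⊔n≤o⇒n≤o _ _ le))
sub-rename-back x z (A ⇒ B)  le =
  cong₂ _⇒_ (sub-rename-back x z A (m⊔n≤o⇒m≤o _ _ le)) (sub-rename-back x z B (m⊔n≤o⇒n≤o _ _ le))
sub-rename-back x z (∀ᶠ y A) le with x ≡ᵇ y
... | true  rewrite <⇒≡ᵇ-false {z} {y} (m⊔n≤o⇒m≤o (suc y) (varBound A) le) =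
  cong (∀ᶠ y) (sub-notFree (var x) z A (notFree-varBound z A (m⊔n≤o⇒n≤o _ _ le)))
... | false rewrite <⇒≡ᵇ-false {z} {y} (m⊔n≤o⇒m≤o (suc y) (varBound A) le) =
  cong (∀ᶠ y) (sub-rename-back x z A (m⊔n≤o⇒n≤o _ _ le))
sub-rename-back x z (∃ᶠ y A) le with x ≡ᵇ y
... | true  rewrite <⇒≡ᵇ-false {z} {y} (m⊔n≤o⇒m≤o (suc y) (varBound A) le) =
  cong (∃ᶠ y) (sub-notFree (var x) z A (notFree-varBound z A (m⊔n≤o⇒n≤o _ _ le)))
... | false rewrite <⇒≡ᵇ-false {z} {y} (m⊔n≤o⇒m≤o (suc y) (varBound A) le) =
  cong (∃ᶠ y) (sub-rename-back x z A (m⊔n≤o⇒n≤o _ _ le))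

freeFor-rename-back : ∀ x z A → varBound A ≤ z → freeFor (var x) z (sub (var z) x A) ≡ true
freeFor-rename-back x z (pred n k ts) le = refl
freeFor-rename-back x z ⊥ᶠ       le = refl
freeFor-rename-back x z (∼ A)    le = freeFor-rename-back x z A le
freeFor-rename-back x z (A ∧ᶠ B) le =
  cong₂ _∧_ (freeFor-rename-back x z A (m⊔n≤o⇒m≤o _ _ le)) (freeFor-rename-back x z B (m⊔n≤o⇒n≤o _ _ le))
freeFor-rename-back x z (A ∨ᶠ B) le =
  cong₂ _∧_ (freeFor-rename-back x z A (m⊔n≤o⇒m≤o _ _ le)) (freeFor-rename-back x z B (m⊔n≤o⇒n≤o _ _ le))
freeFor-rename-back x z (A ⇒ B)  le =
  cong₂ _∧_ (freeFor-rename-back x z A (m⊔n≤o⇒m≤o _ _ le)) (freeFor-rename-back x z B (m⊔n≤o⇒n≤o _ _ le))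
freeFor-rename-back x z (∀ᶠ y A) le with x ≡ᵇ y in e
... | true  rewrite notFree-varBound z (∀ᶠ y A) le = refl
... | false rewrite ≡ᵇ-sym y x | e | freeFor-rename-back x z A (m⊔n≤o⇒n≤o _ _ le) = ∨-zeroʳ _
freeFor-rename-back x z (∃ᶠ y A) le with x ≡ᵇ y in e
... | true  rewrite notFree-varBound z (∃ᶠ y A) le = refl
... | false rewrite ≡ᵇ-sym y x | e | freeFor-rename-back x z A (m⊔n≤o⇒n≤o _ _ le) = ∨-zeroʳ _

csubT : (Con → Term) → Term → Term
csubT g (var x) = var x
csubT g (con c) = g c

csubTs : ∀ {n} → (Con → Term) → Vec Term n → Vec Term n
csubTs g []       = []
csubTs g (u ∷ us) = csubT g u ∷ csubTs g us

csub : (Con → Term) → Form → Form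
csub g (pred n k ts) = pred n k (csubTs g ts)
csub g ⊥ᶠ       = ⊥ᶠ
csub g (∼ A)    = ∼ csub g A
csub g (A ∧ᶠ B) = csub g A ∧ᶠ csub g B
csub g (A ∨ᶠ B) = csub g A ∨ᶠ csub g B
csub g (A ⇒ B)  = csub g A ⇒ csub g B
csub g (∀ᶠ y A) = ∀ᶠ y (csub g A)
csub g (∃ᶠ y A) = ∃ᶠ y (csub g A)

Avoids : (Con → Term) → Var → Set
Avoids g y = ∀ c → occT y (g c) ≡ false

AvoidsBelow : (Con → Term) → ℕ → Set
AvoidsBelow g n = ∀ y → y < n → Avoids g y

avoidsBelow-mono : ∀ {g m n} → m ≤ n → AvoidsBelow g n → AvoidsBelow g m
avoidsBelow-mono m≤n av y y<m = av y (≤-trans y<m m≤n)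

csubT-sub : ∀ g t x u → Avoids g x → csubT g (subT t x u) ≡ subT (csubT g t) x (csubT g u)
csubT-sub g t x (var y) gx with x ≡ᵇ y
... | true  = refl
... | false = refl
csubT-sub g t x (con c) gx = sym (subT-notOcc (csubT g t) x (g c) (gx c))

csubTs-sub : ∀ {n} g t x (us : Vec Term n) → Avoids g x →
             csubTs g (subTs t x us) ≡ subTs (csubT g t) x (csubTs g us)
csubTs-sub g t x []       gx = refl
csubTs-sub g t x (u ∷ us) gx = cong₂ _∷_ (csubT-sub g t x u gx) (csubTs-sub g t x us gx)

csub-sub : ∀ g t x A → Avoids g x → csub g (sub t x A) ≡ sub (csubT g t) x (csub g A)
csub-sub g t x (pred n k ts) gx = cong (pred n k) (csubTs-sub g t x ts gx)
csub-sub g t x ⊥ᶠ       gx = refl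
csub-sub g t x (∼ A)    gx = cong ∼_ (csub-sub g t x A gx)
csub-sub g t x (A ∧ᶠ B) gx = cong₂ _∧ᶠ_ (csub-sub g t x A gx) (csub-sub g t x B gx)
csub-sub g t x (A ∨ᶠ B) gx = cong₂ _∨ᶠ_ (csub-sub g t x A gx) (csub-sub g t x B gx)
csub-sub g t x (A ⇒ B)  gx = cong₂ _⇒_ (csub-sub g t x A gx) (csub-sub g t x B gx)
csub-sub g t x (∀ᶠ y A) gx with x ≡ᵇ y
... | true  = refl
... | false = cong (∀ᶠ y) (csub-sub g t x A gx)
csub-sub g t x (∃ᶠ y A) gx with x ≡ᵇ y
... | true  = refl
... | false = cong (∃ᶠ y) (csub-sub g t x A gx)

occT-csubT : ∀ g v u → Avoids g v → occT v (csubT g u) ≡ occT v u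
occT-csubT g v (var x) gv = refl
occT-csubT g v (con c) gv = gv c

occTs-csubTs : ∀ {n} g v (us : Vec Term n) → Avoids g v → occTs v (csubTs g us) ≡ occTs v us
occTs-csubTs g v []       gv = refl
occTs-csubTs g v (u ∷ us) gv = cong₂ _∨_ (occT-csubT g v u gv) (occTs-csubTs g v us gv)

occursFree-csub : ∀ g v A → Avoids g v → occursFree v (csub g A) ≡ occursFree v A
occursFree-csub g v (pred n k ts) gv = occTs-csubTs g v ts gv
occursFree-csub g v ⊥ᶠ       gv = refl
occursFree-csub g v (∼ A)    gv = occursFree-csub g v A gv
occursFree-csub g v (A ∧ᶠ B) gv = cong₂ _∨_ (occursFree-csub g v A gv) (occursFree-csub g v B gv)
occursFree-csub g v (A ∨ᶠ B) gv = cong₂ _∨_ (occursFree-csub g v A gv) (occursFree-csub g v B gv)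
occursFree-csub g v (A ⇒ B)  gv = cong₂ _∨_ (occursFree-csub g v A gv) (occursFree-csub g v B gv)
occursFree-csub g v (∀ᶠ y A) gv = cong (if v ≡ᵇ y then false else_) (occursFree-csub g v A gv)
occursFree-csub g v (∃ᶠ y A) gv = cong (if v ≡ᵇ y then false else_) (occursFree-csub g v A gv)

private
  freeFor-binder : ∀ a b b' f f' → b ≡ b' → (f ≡ true → f' ≡ true) →
                   a ∨ (not b ∧ f) ≡ true → a ∨ (not b' ∧ f') ≡ true
  freeFor-binder true  b     b'     f f' _    _ _ = refl
  freeFor-binder false false .false f f' refl h e = h e

freeFor-csub : ∀ g t x A → AvoidsBelow g (varBound A) → Avoids g x →
               freeFor t x A ≡ true → freeFor (csubT g t) x (csub g A) ≡ true
freeFor-csub g t x (pred n k ts) av gx ff = refl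
freeFor-csub g t x ⊥ᶠ       av gx ff = refl
freeFor-csub g t x (∼ A)    av gx ff = freeFor-csub g t x A av gx ff
freeFor-csub g t x (A ∧ᶠ B) av gx ff =
  cong₂ _∧_ (freeFor-csub g t x A (avoidsBelow-mono {g} (m≤m⊔n _ _) av) gx (∧-conicalˡ _ _ ff))
            (freeFor-csub g t x B (avoidsBelow-mono {g} (m≤n⊔m _ _) av) gx (∧-conicalʳ _ _ ff))
freeFor-csub g t x (A ∨ᶠ B) av gx ff =
  cong₂ _∧_ (freeFor-csub g t x A (avoidsBelow-mono {g} (m≤m⊔n _ _) av) gx (∧-conicalˡ _ _ ff))
            (freeFor-csub g t x B (avoidsBelow-mono {g} (m≤n⊔m _ _) av) gx (∧-conicalʳ _ _ ff))
freeFor-csub g t x (A ⇒ B)  av gx ff =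
  cong₂ _∧_ (freeFor-csub g t x A (avoidsBelow-mono {g} (m≤m⊔n _ _) av) gx (∧-conicalˡ _ _ ff))
            (freeFor-csub g t x B (avoidsBelow-mono {g} (m≤n⊔m _ _) av) gx (∧-conicalʳ _ _ ff))
freeFor-csub g t x (∀ᶠ y A) av gx ff =
  subst (λ o → not o ∨ (not (occT y (csubT g t)) ∧ freeFor (csubT g t) x (csub g A)) ≡ true)
        (sym (occursFree-csub g x (∀ᶠ y A) gx))
        (freeFor-binder _ _ _ _ _ (sym (occT-csubT g y t (av y (m≤m⊔n (suc y) (varBound A)))))
                        (freeFor-csub g t x A (avoidsBelow-mono {g} (m≤n⊔m _ _) av) gx) ff)
freeFor-csub g t x (∃ᶠ y A) av gx ff =
  subst (λ o → not o ∨ (not (occT y (csubT g t)) ∧ freeFor (csubT g t) x (csub g A)) ≡ true)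
        (sym (occursFree-csub g x (∃ᶠ y A) gx))
        (freeFor-binder _ _ _ _ _ (sym (occT-csubT g y t (av y (m≤m⊔n (suc y) (varBound A)))))
                        (freeFor-csub g t x A (avoidsBelow-mono {g} (m≤n⊔m _ _) av) gx) ff)

Axiom-csub : ∀ g φ → AvoidsBelow g (varBound φ) → Axiom φ → Axiom (csub g φ)
Axiom-csub g _ av (ax1 A B)    = ax1 _ _
Axiom-csub g _ av (ax2 A B C)  = ax2 _ _ _
Axiom-csub g _ av (ax4 A B)    = ax4 _ _
Axiom-csub g _ av (ax5 A B)    = ax5 _ _
Axiom-csub g _ av (ax6 A B C)  = ax6 _ _ _
Axiom-csub g _ av (ax7 A B)    = ax7 _ _
Axiom-csub g _ av (ax8 A B)    = ax8 _ _
Axiom-csub g _ av (ax9 A B C)  = ax9 _ _ _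
Axiom-csub g _ av (ax10 A)     = ax10 _
Axiom-csub g _ av (ax11 A x t ff) =
  subst (λ F → Axiom (F ⇒ ∃ᶠ x (csub g A))) (sym (csub-sub g t x A gx))
        (ax11 (csub g A) x (csubT g t) (freeFor-csub g t x A avA gx ff))
  where
  ∃-bound : suc x ⊔ varBound A ≤ varBound (sub t x A ⇒ ∃ᶠ x A)
  ∃-bound = m≤n⊔m (varBound (sub t x A)) _
  gx : Avoids g x
  gx = av x (≤-trans (m≤m⊔n (suc x) (varBound A)) ∃-bound)
  avA : AvoidsBelow g (varBound A)
  avA = avoidsBelow-mono {g} (≤-trans (m≤n⊔m (suc x) (varBound A)) ∃-bound) av
Axiom-csub g _ av (ax12 A B x nf) =
  ax12 _ _ x (trans (occursFree-csub g x B (av x (≤-trans (m≤m⊔n (suc x) (varBound A ⊔ varBound B)) (m≤m⊔n _ _)))) nf)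
Axiom-csub g _ av (ax13 A B x nf) =
  ax13 _ _ x (trans (occursFree-csub g x B (av x (≤-trans (m≤m⊔n (suc x) (varBound B ⊔ varBound A)) (m≤m⊔n _ _)))) nf)
Axiom-csub g _ av (ax14 A x t ff) =
  subst (λ F → Axiom (∀ᶠ x (csub g A) ⇒ F)) (sym (csub-sub g t x A gx))
        (ax14 (csub g A) x (csubT g t) (freeFor-csub g t x A avA gx ff))
  where
  ∀-bound : suc x ⊔ varBound A ≤ varBound (∀ᶠ x A ⇒ sub t x A)
  ∀-bound = m≤m⊔n _ (varBound (sub t x A))
  gx : Avoids g x
  gx = av x (≤-trans (m≤m⊔n (suc x) (varBound A)) ∀-bound)
  avA : AvoidsBelow g (varBound A)
  avA = avoidsBelow-mono {g} (≤-trans (m≤n⊔m (suc x) (varBound A)) ∀-bound) av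
Axiom-csub g _ av (ax15 A)     = ax15 _
Axiom-csub g _ av (ax16 A)     = ax16 _
Axiom-csub g _ av (ax17 A B)   = ax17 _ _
Axiom-csub g _ av (ax18 A B)   = ax18 _ _
Axiom-csub g _ av (ax19 A B)   = ax19 _ _
Axiom-csub g _ av (ax20 A x)   = ax20 _ x
Axiom-csub g _ av (ax21 A x)   = ax21 _ x

varBoundᵈ : ∀ {Γ A} → Γ ⊢ᵢ A → ℕ
varBoundᵈ (hyp {A} _) = varBound A
varBoundᵈ (ax {A} _)  = varBound A
varBoundᵈ (mp d e)    = varBoundᵈ d ⊔ varBoundᵈ e
varBoundᵈ (gen x d)   = suc x ⊔ varBoundᵈ d

csub-⊢ : ∀ {Γ Δ A} g (d : Γ ⊢ᵢ A) → AvoidsBelow g (varBoundᵈ d) →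
         (∀ {ψ} → Γ ψ → Δ (csub g ψ)) → Δ ⊢ᵢ csub g A
csub-⊢ g (hyp h)         av Γ⇒Δ = hyp (Γ⇒Δ h)
csub-⊢ g (ax {A} a)      av Γ⇒Δ = ax (Axiom-csub g A av a)
csub-⊢ g (mp d e)        av Γ⇒Δ =
  mp (csub-⊢ g d (avoidsBelow-mono {g} (m≤m⊔n _ _) av) Γ⇒Δ) (csub-⊢ g e (avoidsBelow-mono {g} (m≤n⊔m _ _) av) Γ⇒Δ)
csub-⊢ g (gen x d)       av Γ⇒Δ = gen x (csub-⊢ g d (avoidsBelow-mono {g} (m≤n⊔m _ _) av) Γ⇒Δ)

AllConT : Pred Con 0ℓ → Term → Set
AllConT P (var _) = ⊤
AllConT P (con c) = P c

AllCon : Pred Con 0ℓ → Form → Set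
AllCon P (pred n k ts) = All (AllConT P) ts
AllCon P ⊥ᶠ       = ⊤
AllCon P (∼ A)    = AllCon P A
AllCon P (A ∧ᶠ B) = AllCon P A × AllCon P B
AllCon P (A ∨ᶠ B) = AllCon P A × AllCon P B
AllCon P (A ⇒ B)  = AllCon P A × AllCon P B
AllCon P (∀ᶠ y A) = AllCon P A
AllCon P (∃ᶠ y A) = AllCon P A

AllConT-mono : ∀ {P Q : Pred Con 0ℓ} → P ⊆ Q → AllConT P ⊆ AllConT Q
AllConT-mono P⊆Q {var x} _ = tt
AllConT-mono P⊆Q {con c} p = P⊆Q p

AllCon-mono : ∀ {P Q : Pred Con 0ℓ} → P ⊆ Q → ∀ A → AllCon P A → AllCon Q A
AllCon-mono {P} {Q} P⊆Q (pred n k ts) a = All.map (λ {u} → AllConT-mono {P} {Q} P⊆Q {u}) a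
AllCon-mono P⊆Q ⊥ᶠ       a       = tt
AllCon-mono P⊆Q (∼ A)    a       = AllCon-mono P⊆Q A a
AllCon-mono P⊆Q (A ∧ᶠ B) (a , b) = AllCon-mono P⊆Q A a , AllCon-mono P⊆Q B b
AllCon-mono P⊆Q (A ∨ᶠ B) (a , b) = AllCon-mono P⊆Q A a , AllCon-mono P⊆Q B b
AllCon-mono P⊆Q (A ⇒ B)  (a , b) = AllCon-mono P⊆Q A a , AllCon-mono P⊆Q B b
AllCon-mono P⊆Q (∀ᶠ y A) a       = AllCon-mono P⊆Q A a
AllCon-mono P⊆Q (∃ᶠ y A) a       = AllCon-mono P⊆Q A a

AllConT-sub : ∀ {P} c x u → P c → AllConT P u → AllConT P (subT (con c) x u)
AllConT-sub c x (var y) pc a with x ≡ᵇ y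
... | true  = pc
... | false = tt
AllConT-sub c x (con c') pc a = a

AllConTs-sub : ∀ {P n} c x (us : Vec Term n) → P c → All (AllConT P) us → All (AllConT P) (subTs (con c) x us)
AllConTs-sub c x []       pc []       = []
AllConTs-sub c x (u ∷ us) pc (a ∷ as) = AllConT-sub c x u pc a ∷ AllConTs-sub c x us pc as

AllCon-sub : ∀ {P} c x A → P c → AllCon P A → AllCon P (sub (con c) x A)
AllCon-sub c x (pred n k ts) pc a       = AllConTs-sub c x ts pc a
AllCon-sub c x ⊥ᶠ       pc a       = tt
AllCon-sub c x (∼ A)    pc a       = AllCon-sub c x A pc a
AllCon-sub c x (A ∧ᶠ B) pc (a , b) = AllCon-sub c x A pc a , AllCon-sub c x B pc b
AllCon-sub c x (A ∨ᶠ B) pc (a , b) = AllCon-sub c x A pc a , AllCon-sub c x B pc b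
AllCon-sub c x (A ⇒ B)  pc (a , b) = AllCon-sub c x A pc a , AllCon-sub c x B pc b
AllCon-sub c x (∀ᶠ y A) pc a with x ≡ᵇ y
... | true  = a
... | false = AllCon-sub c x A pc a
AllCon-sub c x (∃ᶠ y A) pc a with x ≡ᵇ y
... | true  = a
... | false = AllCon-sub c x A pc a

conBoundT : Term → ℕ
conBoundT (var _) = 0
conBoundT (con c) = suc c

conBoundTs : ∀ {n} → Vec Term n → ℕ
conBoundTs []       = 0
conBoundTs (u ∷ us) = conBoundT u ⊔ conBoundTs us

conBound : Form → ℕ
conBound (pred n k ts) = conBoundTs ts
conBound ⊥ᶠ       = 0
conBound (∼ A)    = conBound A
conBound (A ∧ᶠ B) = conBound A ⊔ conBound B
conBound (A ∨ᶠ B) = conBound A ⊔ conBound B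
conBound (A ⇒ B)  = conBound A ⊔ conBound B
conBound (∀ᶠ y A) = conBound A
conBound (∃ᶠ y A) = conBound A

AllConT-conBoundT : ∀ {m} u → conBoundT u ≤ m → AllConT (_< m) u
AllConT-conBoundT (var x) le = tt
AllConT-conBoundT (con c) le = le

AllConTs-conBoundTs : ∀ {m n} (us : Vec Term n) → conBoundTs us ≤ m → All (AllConT (_< m)) us
AllConTs-conBoundTs []       le = []
AllConTs-conBoundTs (u ∷ us) le =
  AllConT-conBoundT u (m⊔n≤o⇒m≤o _ _ le) ∷ AllConTs-conBoundTs us (m⊔n≤o⇒n≤o _ _ le)

AllCon-conBound : ∀ {m} A → conBound A ≤ m → AllCon (_< m) A
AllCon-conBound (pred n k ts) le = AllConTs-conBoundTs ts le
AllCon-conBound ⊥ᶠ       le = tt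
AllCon-conBound (∼ A)    le = AllCon-conBound A le
AllCon-conBound (A ∧ᶠ B) le = AllCon-conBound A (m⊔n≤o⇒m≤o _ _ le) , AllCon-conBound B (m⊔n≤o⇒n≤o _ _ le)
AllCon-conBound (A ∨ᶠ B) le = AllCon-conBound A (m⊔n≤o⇒m≤o _ _ le) , AllCon-conBound B (m⊔n≤o⇒n≤o _ _ le)
AllCon-conBound (A ⇒ B)  le = AllCon-conBound A (m⊔n≤o⇒m≤o _ _ le) , AllCon-conBound B (m⊔n≤o⇒n≤o _ _ le)
AllCon-conBound (∀ᶠ y A) le = AllCon-conBound A le
AllCon-conBound (∃ᶠ y A) le = AllCon-conBound A le

Fresh : Con → Form → Set
Fresh c = AllCon (_≢ c)

conBound⇒Fresh : ∀ {c} φ → conBound φ ≤ c → Fresh c φ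
conBound⇒Fresh φ φ≤c = AllCon-mono (λ { c'<c refl → <-irrefl refl c'<c }) φ (AllCon-conBound φ φ≤c)

conToVar : Con → Var → Con → Term
conToVar c z c' = if c' ≡ᵇ c then var z else con c'

conToVar-avoids : ∀ c z y → y ≢ z → Avoids (conToVar c z) y
conToVar-avoids c z y y≢z c' with c' ≡ᵇ c
... | true  = ≢⇒≡ᵇ-false y z y≢z
... | false = refl

csubT-fresh : ∀ c z u → AllConT (_≢ c) u → csubT (conToVar c z) u ≡ u
csubT-fresh c z (var x)  _    = refl
csubT-fresh c z (con c') c'≢c rewrite ≢⇒≡ᵇ-false c' c c'≢c = refl

csubTs-fresh : ∀ {n} c z (us : Vec Term n) → All (AllConT (_≢ c)) us → csubTs (conToVar c z) us ≡ us
csubTs-fresh c z []       []       = refl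
csubTs-fresh c z (u ∷ us) (a ∷ as) = cong₂ _∷_ (csubT-fresh c z u a) (csubTs-fresh c z us as)

csub-fresh : ∀ c z A → Fresh c A → csub (conToVar c z) A ≡ A
csub-fresh c z (pred n k ts) a       = cong (pred n k) (csubTs-fresh c z ts a)
csub-fresh c z ⊥ᶠ       a       = refl
csub-fresh c z (∼ A)    a       = cong ∼_ (csub-fresh c z A a)
csub-fresh c z (A ∧ᶠ B) (a , b) = cong₂ _∧ᶠ_ (csub-fresh c z A a) (csub-fresh c z B b)
csub-fresh c z (A ∨ᶠ B) (a , b) = cong₂ _∨ᶠ_ (csub-fresh c z A a) (csub-fresh c z B b)
csub-fresh c z (A ⇒ B)  (a , b) = cong₂ _⇒_ (csub-fresh c z A a) (csub-fresh c z B b)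
csub-fresh c z (∀ᶠ y A) a       = cong (∀ᶠ y) (csub-fresh c z A a)
csub-fresh c z (∃ᶠ y A) a       = cong (∃ᶠ y) (csub-fresh c z A a)

infixl 5 _,,_

_,,_ : Pred Form 0ℓ → Form → Pred Form 0ℓ
Γ ,, φ = Γ ∪ ｛ φ ｝

weaken : ∀ {Γ Δ A} → Γ ⊆ Δ → Γ ⊢ᵢ A → Δ ⊢ᵢ A
weaken Γ⊆Δ (hyp h)   = hyp (Γ⊆Δ h)
weaken Γ⊆Δ (ax a)    = ax a
weaken Γ⊆Δ (mp d e)  = mp (weaken Γ⊆Δ d) (weaken Γ⊆Δ e)
weaken Γ⊆Δ (gen x d) = gen x (weaken Γ⊆Δ d)

here : ∀ {Γ φ} → Γ ,, φ ⊢ᵢ φ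
here = hyp (inj₂ refl)

⊢-id : ∀ {Γ} A → Γ ⊢ᵢ A ⇒ A
⊢-id A = mp (ax (ax1 A A)) (mp (ax (ax1 A (A ⇒ A))) (ax (ax2 A (A ⇒ A) A)))

⊢-const : ∀ {Γ A} B → Γ ⊢ᵢ A → Γ ⊢ᵢ B ⇒ A
⊢-const B d = mp d (ax (ax1 _ B))

-- The side condition of Ax13 is why the hypothesis must be a sentence.
deduction : ∀ {Γ φ ψ} → Sentence φ → Γ ,, φ ⊢ᵢ ψ → Γ ⊢ᵢ φ ⇒ ψ
deduction s (hyp (inj₁ h))    = ⊢-const _ (hyp h)
deduction s (hyp (inj₂ refl)) = ⊢-id _
deduction s (ax a)            = ⊢-const _ (ax a)
deduction s (mp d e)          = mp (deduction s d) (mp (deduction s e) (ax (ax2 _ _ _)))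
deduction {φ = φ} s (gen x d) = mp (gen x (deduction s d)) (ax (ax13 _ φ x (s x)))

cut : ∀ {Γ φ ψ} → Γ ⊢ᵢ φ → Γ ,, φ ⊢ᵢ ψ → Γ ⊢ᵢ ψ
cut p (hyp (inj₁ h))    = hyp h
cut p (hyp (inj₂ refl)) = p
cut p (ax a)            = ax a
cut p (mp d e)          = mp (cut p d) (cut p e)
cut p (gen x d)         = gen x (cut p d)

⊤ᶠ : Form
⊤ᶠ = ⊥ᶠ ⇒ ⊥ᶠ

⊢⊤ : ∀ {Γ} → Γ ⊢ᵢ ⊤ᶠ
⊢⊤ = ax (ax10 ⊥ᶠ)

∧-intro : ∀ {Γ A B} → Γ ⊢ᵢ A → Γ ⊢ᵢ B → Γ ⊢ᵢ A ∧ᶠ B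
∧-intro a b = mp ⊢⊤ (mp (⊢-const ⊤ᶠ b) (mp (⊢-const ⊤ᶠ a) (ax (ax6 _ _ ⊤ᶠ))))

∧-elimˡ : ∀ {Γ A B} → Γ ⊢ᵢ A ∧ᶠ B → Γ ⊢ᵢ A
∧-elimˡ d = mp d (ax (ax4 _ _))

∧-elimʳ : ∀ {Γ A B} → Γ ⊢ᵢ A ∧ᶠ B → Γ ⊢ᵢ B
∧-elimʳ d = mp d (ax (ax5 _ _))

∨-elim : ∀ {Γ A B C} → Γ ⊢ᵢ A ∨ᶠ B → Γ ⊢ᵢ A ⇒ C → Γ ⊢ᵢ B ⇒ C → Γ ⊢ᵢ C
∨-elim d f g = mp d (mp g (mp f (ax (ax9 _ _ _))))

Axiom-⇔ : ∀ {Γ A B} → Axiom (A ⇔ᶠ B) → (Γ ⊢ᵢ A) ⇔ (Γ ⊢ᵢ B)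
Axiom-⇔ a = mk⇔ (λ d → mp d (∧-elimˡ (ax a))) (λ d → mp d (∧-elimʳ (ax a)))

-- Replace c by a variable z that is new to the whole derivation, generalise on z,
-- and instantiate back to x.
gen-con : ∀ {Δ} c x Y → (∀ {ψ} → Δ ψ → Fresh c ψ) → Fresh c Y →
          Δ ⊢ᵢ sub (con c) x Y → Δ ⊢ᵢ ∀ᶠ x Y
gen-con {Δ} c x Y Δ-fresh Y-fresh d = gen x (subst (Δ ⊢ᵢ_) (sub-rename-back x z Y Y<z) renamed)
  where
  z : Var
  z = suc (varBoundᵈ d ⊔ (varBound Y ⊔ x))
  Y<z : varBound Y ≤ z
  Y<z = m≤n⇒m≤1+n (≤-trans (m≤m⊔n (varBound Y) x) (m≤n⊔m (varBoundᵈ d) _))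
  g : Con → Term
  g = conToVar c z
  avoids-d : AvoidsBelow g (varBoundᵈ d)
  avoids-d y y<d = conToVar-avoids c z y λ y≡z → <-irrefl y≡z (m≤n⇒m≤1+n (≤-trans y<d (m≤m⊔n _ _)))
  avoids-x : Avoids g x
  avoids-x = conToVar-avoids c z x λ x≡z →
    <-irrefl x≡z (s≤s (≤-trans (m≤n⊔m (varBound Y) x) (m≤n⊔m (varBoundᵈ d) _)))
  at-z : Δ ⊢ᵢ sub (var z) x Y
  at-z = subst (Δ ⊢ᵢ_)
    (trans (csub-sub g (con c) x Y avoids-x)
           (cong₂ (λ t F → sub t x F) (cong (λ b → if b then var z else con c) (≡ᵇ-refl c)) (csub-fresh c z Y Y-fresh)))
    (csub-⊢ g d avoids-d λ {ψ} h → subst Δ (sym (csub-fresh c z ψ (Δ-fresh h))) h)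
  renamed : Δ ⊢ᵢ sub (var x) z (sub (var z) x Y)
  renamed = mp (gen z at-z) (ax (ax14 (sub (var z) x Y) z (var x) (freeFor-rename-back x z Y Y<z)))

-- Semantics

module Semantics (M : Model) where
  open Model M renaming (_≤_ to _≼_; ≤-refl to ≼-refl; ≤-trans to ≼-trans)

  Env : Set
  Env = Var → Elem M

  □-⇔ : ∀ {w} {P Q : W → Set} → (∀ x → w ≼ x → P x ⇔ Q x) →
        (∀ x → w ≼ x → P x) ⇔ (∀ x → w ≼ x → Q x)
  □-⇔ P⇔Q = mk⇔ (λ f x w≼x → to (P⇔Q x w≼x) (f x w≼x)) (λ f x w≼x → from (P⇔Q x w≼x) (f x w≼x))

  □∀-⇔ : ∀ {w} {P Q : W → Elem M → Set} → (∀ x → w ≼ x → ∀ d → D x d → P x d ⇔ Q x d) →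
         (∀ x → w ≼ x → ∀ d → D x d → P x d) ⇔ (∀ x → w ≼ x → ∀ d → D x d → Q x d)
  □∀-⇔ P⇔Q = mk⇔ (λ f x w≼x d dx → to   (P⇔Q x w≼x d dx) (f x w≼x d dx))
                 (λ f x w≼x d dx → from (P⇔Q x w≼x d dx) (f x w≼x d dx))

  ∃-⇔ : ∀ {w} {P Q : Elem M → Set} → (∀ d → D w d → P d ⇔ Q d) →
        (Σ (Elem M) λ d → D w d × P d) ⇔ (Σ (Elem M) λ d → D w d × Q d)
  ∃-⇔ P⇔Q = mk⇔ (λ (d , dw , p) → d , dw , to (P⇔Q d dw) p) (λ (d , dw , q) → d , dw , from (P⇔Q d dw) q)

  I⁺-mono : ∀ A {w x} ρ → w ≼ x → I⁺ M w ρ A → I⁺ M x ρ A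
  I⁻-mono : ∀ A {w x} ρ → w ≼ x → I⁻ M w ρ A → I⁻ M x ρ A
  I⁺-mono (pred n k ts) ρ w≼x h = V⁺-mono w≼x h
  I⁺-mono (∼ A)    ρ w≼x h = I⁻-mono A ρ w≼x h
  I⁺-mono (A ∧ᶠ B) ρ w≼x (a , b) = I⁺-mono A ρ w≼x a , I⁺-mono B ρ w≼x b
  I⁺-mono (A ∨ᶠ B) ρ w≼x (inj₁ a) = inj₁ (I⁺-mono A ρ w≼x a)
  I⁺-mono (A ∨ᶠ B) ρ w≼x (inj₂ b) = inj₂ (I⁺-mono B ρ w≼x b)
  I⁺-mono (A ⇒ B)  ρ w≼x h y x≼y = h y (≼-trans w≼x x≼y)
  I⁺-mono (∀ᶠ v A) ρ w≼x h y x≼y = h y (≼-trans w≼x x≼y)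
  I⁺-mono (∃ᶠ v A) ρ w≼x (d , dw , a) = d , D-mono w≼x dw , I⁺-mono A (upd M ρ v d) w≼x a
  I⁻-mono (pred n k ts) ρ w≼x h = V⁻-mono w≼x h
  I⁻-mono ⊥ᶠ       ρ w≼x h = tt
  I⁻-mono (∼ A)    ρ w≼x h = I⁺-mono A ρ w≼x h
  I⁻-mono (A ∧ᶠ B) ρ w≼x (inj₁ a) = inj₁ (I⁻-mono A ρ w≼x a)
  I⁻-mono (A ∧ᶠ B) ρ w≼x (inj₂ b) = inj₂ (I⁻-mono B ρ w≼x b)
  I⁻-mono (A ∨ᶠ B) ρ w≼x (a , b) = I⁻-mono A ρ w≼x a , I⁻-mono B ρ w≼x b
  I⁻-mono (A ⇒ B)  ρ w≼x (f , b) = (λ y x≼y → f y (≼-trans w≼x x≼y)) , I⁻-mono B ρ w≼x b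
  I⁻-mono (∀ᶠ v A) ρ w≼x (d , dw , a) = d , D-mono w≼x dw , I⁻-mono A (upd M ρ v d) w≼x a
  I⁻-mono (∃ᶠ v A) ρ w≼x h y x≼y = h y (≼-trans w≼x x≼y)

  record SameValue (w : W) (ρ : Env) (A : Form) (ρ' : Env) (A' : Form) : Set where
    constructor same
    field
      pos : I⁺ M w ρ A ⇔ I⁺ M w ρ' A'
      neg : I⁻ M w ρ A ⇔ I⁻ M w ρ' A'
  open SameValue

  pred-same : ∀ {w n k} ρ ρ' (ts ts' : Vec Term n) →
              Vec.map (evalT M ρ) ts ≡ Vec.map (evalT M ρ') ts' → SameValue w ρ (pred n k ts) ρ' (pred n k ts')
  pred-same {w} {n} {k} ρ ρ' ts ts' eq =
    same (subst (λ ds → _ ⇔ V⁺ w n k ds) eq (⇔-id _)) (subst (λ ds → _ ⇔ V⁻ w n k ds) eq (⇔-id _))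

  ∼-same : ∀ {w ρ ρ' A A'} → SameValue w ρ A ρ' A' → SameValue w ρ (∼ A) ρ' (∼ A')
  ∼-same (same p n) = same n p

  ∧-same : ∀ {w ρ ρ' A A' B B'} → SameValue w ρ A ρ' A' → SameValue w ρ B ρ' B' →
           SameValue w ρ (A ∧ᶠ B) ρ' (A' ∧ᶠ B')
  ∧-same (same p n) (same p' n') = same (p ×-⇔ p') (n ⊎-⇔ n')

  ∨-same : ∀ {w ρ ρ' A A' B B'} → SameValue w ρ A ρ' A' → SameValue w ρ B ρ' B' →
           SameValue w ρ (A ∨ᶠ B) ρ' (A' ∨ᶠ B')
  ∨-same (same p n) (same p' n') = same (p ⊎-⇔ p') (n ×-⇔ n')

  ⇒-same : ∀ {w ρ ρ' A A' B B'} →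
           (∀ x → w ≼ x → SameValue x ρ A ρ' A') → (∀ x → w ≼ x → SameValue x ρ B ρ' B') →
           SameValue w ρ (A ⇒ B) ρ' (A' ⇒ B')
  ⇒-same A≈ B≈ =
    same (□-⇔ λ x w≼x → ¬-cong-⇔ (pos (A≈ x w≼x)) ⊎-⇔ pos (B≈ x w≼x))
         (□-⇔ (λ x w≼x → ¬-cong-⇔ (neg (A≈ x w≼x))) ×-⇔ neg (B≈ _ ≼-refl))

  ∀-same : ∀ {w ρ ρ' y A A'} → (∀ x → w ≼ x → ∀ d → D x d → SameValue x (upd M ρ y d) A (upd M ρ' y d) A') →
           SameValue w ρ (∀ᶠ y A) ρ' (∀ᶠ y A')
  ∀-same A≈ = same (□∀-⇔ λ x w≼x d dx → pos (A≈ x w≼x d dx)) (∃-⇔ λ d dw → neg (A≈ _ ≼-refl d dw))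

  ∃-same : ∀ {w ρ ρ' y A A'} → (∀ x → w ≼ x → ∀ d → D x d → SameValue x (upd M ρ y d) A (upd M ρ' y d) A') →
           SameValue w ρ (∃ᶠ y A) ρ' (∃ᶠ y A')
  ∃-same A≈ = same (∃-⇔ λ d dw → pos (A≈ _ ≼-refl d dw)) (□∀-⇔ λ x w≼x d dx → neg (A≈ x w≼x d dx))

  Agree : Form → Env → Env → Set
  Agree A ρ ρ' = ∀ v → occursFree v A ≡ true → ρ v ≡ ρ' v

  -- Agree (∀ᶠ y A) and Agree (∃ᶠ y A) unfold to the same type.
  agree-upd : ∀ y A ρ ρ' d → Agree (∀ᶠ y A) ρ ρ' → Agree A (upd M ρ y d) (upd M ρ' y d)
  agree-upd y A ρ ρ' d ag v e with v ≡ᵇ y in v≡ᵇy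
  ... | true  = refl
  ... | false = ag v (subst (λ b → (if b then false else occursFree v A) ≡ true) (sym v≡ᵇy) e)

  agree-notFree : ∀ B x e ρ ρ' → NotFree x B → (∀ v → ρ' v ≡ upd M ρ x e v) → Agree B ρ ρ'
  agree-notFree B x e ρ ρ' x∉B ρ'≡ v v∈B with v ≡ᵇ x in v≡ᵇx
  ... | true  rewrite ≡ᵇ-true⇒≡ v x v≡ᵇx with () ← trans (sym x∉B) v∈B
  ... | false = sym (trans (ρ'≡ v) (cong (λ b → if b then e else ρ v) v≡ᵇx))

  evalTs-agree : ∀ {n} (ts : Vec Term n) ρ ρ' → (∀ v → occTs v ts ≡ true → ρ v ≡ ρ' v) →
                 Vec.map (evalT M ρ) ts ≡ Vec.map (evalT M ρ') ts
  evalTs-agree []           ρ ρ' ag = refl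
  evalTs-agree (var x ∷ ts) ρ ρ' ag =
    cong₂ _∷_ (ag x (∨-trueˡ _ (≡ᵇ-refl x))) (evalTs-agree ts ρ ρ' λ v e → ag v (∨-trueʳ _ e))
  evalTs-agree (con c ∷ ts) ρ ρ' ag = cong (_ ∷_) (evalTs-agree ts ρ ρ' λ v e → ag v (∨-trueʳ _ e))

  coincidence : ∀ A w ρ ρ' → Agree A ρ ρ' → SameValue w ρ A ρ' A
  coincidence (pred n k ts) w ρ ρ' ag = pred-same ρ ρ' ts ts (evalTs-agree ts ρ ρ' ag)
  coincidence ⊥ᶠ       w ρ ρ' ag = same (⇔-id _) (⇔-id _)
  coincidence (∼ A)    w ρ ρ' ag = ∼-same (coincidence A w ρ ρ' ag)
  coincidence (A ∧ᶠ B) w ρ ρ' ag =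
    ∧-same (coincidence A w ρ ρ' λ v e → ag v (∨-trueˡ _ e)) (coincidence B w ρ ρ' λ v e → ag v (∨-trueʳ _ e))
  coincidence (A ∨ᶠ B) w ρ ρ' ag =
    ∨-same (coincidence A w ρ ρ' λ v e → ag v (∨-trueˡ _ e)) (coincidence B w ρ ρ' λ v e → ag v (∨-trueʳ _ e))
  coincidence (A ⇒ B)  w ρ ρ' ag =
    ⇒-same (λ x _ → coincidence A x ρ ρ' λ v e → ag v (∨-trueˡ _ e))
           (λ x _ → coincidence B x ρ ρ' λ v e → ag v (∨-trueʳ _ e))
  coincidence (∀ᶠ y A) w ρ ρ' ag = ∀-same λ x _ d _ → coincidence A x _ _ (agree-upd y A ρ ρ' d ag)
  coincidence (∃ᶠ y A) w ρ ρ' ag = ∃-same λ x _ d _ → coincidence A x _ _ (agree-upd y A ρ ρ' d ag)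

  evalT-subT : ∀ t x ρ ρ' → (∀ v → ρ' v ≡ upd M ρ x (evalT M ρ t) v) →
               ∀ u → evalT M ρ (subT t x u) ≡ evalT M ρ' u
  evalT-subT t x ρ ρ' ρ'≡ (var y) with x ≡ᵇ y in x≡ᵇy
  ... | true  = sym (trans (ρ'≡ y) (cong (λ b → if b then evalT M ρ t else ρ y) (trans (≡ᵇ-sym y x) x≡ᵇy)))
  ... | false = sym (trans (ρ'≡ y) (cong (λ b → if b then evalT M ρ t else ρ y) (trans (≡ᵇ-sym y x) x≡ᵇy)))
  evalT-subT t x ρ ρ' ρ'≡ (con c) = refl

  evalTs-subTs : ∀ {n} t x ρ ρ' → (∀ v → ρ' v ≡ upd M ρ x (evalT M ρ t) v) → (ts : Vec Term n) →
                 Vec.map (evalT M ρ) (subTs t x ts) ≡ Vec.map (evalT M ρ') ts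
  evalTs-subTs t x ρ ρ' ρ'≡ []       = refl
  evalTs-subTs t x ρ ρ' ρ'≡ (u ∷ us) = cong₂ _∷_ (evalT-subT t x ρ ρ' ρ'≡ u) (evalTs-subTs t x ρ ρ' ρ'≡ us)

  evalT-upd-notOcc : ∀ t y ρ d → occT y t ≡ false → evalT M (upd M ρ y d) t ≡ evalT M ρ t
  evalT-upd-notOcc (var u) y ρ d y∉t rewrite ≡ᵇ-sym u y | y∉t = refl
  evalT-upd-notOcc (con c) y ρ d y∉t = refl

  upd-comm : ∀ t x y ρ ρ' d → (x ≡ᵇ y) ≡ false → occT y t ≡ false →
             (∀ v → ρ' v ≡ upd M ρ x (evalT M ρ t) v) →
             ∀ v → upd M ρ' y d v ≡ upd M (upd M ρ y d) x (evalT M (upd M ρ y d) t) v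
  upd-comm t x y ρ ρ' d x≢y y∉t ρ'≡ v with v ≡ᵇ y in v≡ᵇy | v ≡ᵇ x in v≡ᵇx
  ... | true  | true  rewrite ≡ᵇ-true⇒≡ v x v≡ᵇx | ≡ᵇ-true⇒≡ x y v≡ᵇy | ≡ᵇ-refl y with () ← x≢y
  ... | true  | false = refl
  ... | false | true  = trans (ρ'≡ v) (trans (cong (λ b → if b then evalT M ρ t else ρ v) v≡ᵇx)
                                             (sym (evalT-upd-notOcc t y ρ d y∉t)))
  ... | false | false = trans (ρ'≡ v) (cong (λ b → if b then evalT M ρ t else ρ v) v≡ᵇx)

  private
    bound-var-≢ : ∀ x y A → (if x ≡ᵇ y then false else occursFree x A) ≡ true → (x ≡ᵇ y) ≡ false
    bound-var-≢ x y A e with x ≡ᵇ y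
    ... | false = refl

    sub-∀ : ∀ t x y A → (x ≡ᵇ y) ≡ false → sub t x (∀ᶠ y A) ≡ ∀ᶠ y (sub t x A)
    sub-∀ t x y A x≢y rewrite x≢y = refl

    sub-∃ : ∀ t x y A → (x ≡ᵇ y) ≡ false → sub t x (∃ᶠ y A) ≡ ∃ᶠ y (sub t x A)
    sub-∃ t x y A x≢y rewrite x≢y = refl

    not-true : ∀ {b} → not b ≡ true → b ≡ false
    not-true {false} _ = refl

  substitution : ∀ A t x → freeFor t x A ≡ true → ∀ w ρ ρ' → (∀ v → ρ' v ≡ upd M ρ x (evalT M ρ t) v) →
                 SameValue w ρ (sub t x A) ρ' A
  substitution (pred n k ts) t x ff w ρ ρ' ρ'≡ = pred-same ρ ρ' _ ts (evalTs-subTs t x ρ ρ' ρ'≡ ts)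
  substitution ⊥ᶠ       t x ff w ρ ρ' ρ'≡ = same (⇔-id _) (⇔-id _)
  substitution (∼ A)    t x ff w ρ ρ' ρ'≡ = ∼-same (substitution A t x ff w ρ ρ' ρ'≡)
  substitution (A ∧ᶠ B) t x ff w ρ ρ' ρ'≡ =
    ∧-same (substitution A t x (∧-conicalˡ _ _ ff) w ρ ρ' ρ'≡) (substitution B t x (∧-conicalʳ _ _ ff) w ρ ρ' ρ'≡)
  substitution (A ∨ᶠ B) t x ff w ρ ρ' ρ'≡ =
    ∨-same (substitution A t x (∧-conicalˡ _ _ ff) w ρ ρ' ρ'≡) (substitution B t x (∧-conicalʳ _ _ ff) w ρ ρ' ρ'≡)
  substitution (A ⇒ B)  t x ff w ρ ρ' ρ'≡ =
    ⇒-same (λ z _ → substitution A t x (∧-conicalˡ _ _ ff) z ρ ρ' ρ'≡)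
           (λ z _ → substitution B t x (∧-conicalʳ _ _ ff) z ρ ρ' ρ'≡)
  substitution (∀ᶠ y A) t x ff w ρ ρ' ρ'≡ with occursFree x (∀ᶠ y A) in x∈∀yA
  ... | false = subst (λ F → SameValue w ρ F ρ' (∀ᶠ y A)) (sym (sub-notFree t x (∀ᶠ y A) x∈∀yA))
                      (coincidence (∀ᶠ y A) w ρ ρ' (agree-notFree (∀ᶠ y A) x _ ρ ρ' x∈∀yA ρ'≡))
  ... | true  = subst (λ F → SameValue w ρ F ρ' (∀ᶠ y A)) (sym (sub-∀ t x y A x≢y))
                      (∀-same λ z _ d _ →
                         substitution A t x (∧-conicalʳ _ _ ff) z _ _ (upd-comm t x y ρ ρ' d x≢y y∉t ρ'≡))
    where
    x≢y : (x ≡ᵇ y) ≡ false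
    x≢y = bound-var-≢ x y A x∈∀yA
    y∉t : occT y t ≡ false
    y∉t = not-true (∧-conicalˡ _ _ ff)
  substitution (∃ᶠ y A) t x ff w ρ ρ' ρ'≡ with occursFree x (∃ᶠ y A) in x∈∃yA
  ... | false = subst (λ F → SameValue w ρ F ρ' (∃ᶠ y A)) (sym (sub-notFree t x (∃ᶠ y A) x∈∃yA))
                      (coincidence (∃ᶠ y A) w ρ ρ' (agree-notFree (∃ᶠ y A) x _ ρ ρ' x∈∃yA ρ'≡))
  ... | true  = subst (λ F → SameValue w ρ F ρ' (∃ᶠ y A)) (sym (sub-∃ t x y A x≢y))
                      (∃-same λ z _ d _ →
                         substitution A t x (∧-conicalʳ _ _ ff) z _ _ (upd-comm t x y ρ ρ' d x≢y y∉t ρ'≡))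
    where
    x≢y : (x ≡ᵇ y) ≡ false
    x≢y = bound-var-≢ x y A x∈∃yA
    y∉t : occT y t ≡ false
    y∉t = not-true (∧-conicalˡ _ _ ff)

  sentence-persistent : ∀ {w} B → Sentence B → true⁺ M w B → ∀ x → w ≼ x → ∀ ρ → I⁺ M x ρ B
  sentence-persistent {w} B B-sent B-true x w≼x ρ =
    to (pos (coincidence B x _ ρ λ v v∈B → ⊥-elim (sentence-closed {B} B-sent v v∈B)))
       (I⁺-mono B _ w≼x B-true)

  InDomain : W → Env → Set
  InDomain w ρ = ∀ v → D w (ρ v)

  InDomain-mono : ∀ {w x ρ} → w ≼ x → InDomain w ρ → InDomain x ρ
  InDomain-mono w≼x ρ∈w v = D-mono w≼x (ρ∈w v)

  InDomain-upd : ∀ {w ρ} y d → InDomain w ρ → D w d → InDomain w (upd M ρ y d)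
  InDomain-upd y d ρ∈w d∈w v with v ≡ᵇ y
  ... | true  = d∈w
  ... | false = ρ∈w v

  evalT-InDomain : ∀ {w ρ} t → InDomain w ρ → D w (evalT M ρ t)
  evalT-InDomain (var v) ρ∈w = ρ∈w v
  evalT-InDomain (con c) ρ∈w = D-con _ c

  upd-notFree : ∀ B w x ρ d → NotFree x B → I⁺ M w (upd M ρ x d) B → I⁺ M w ρ B
  upd-notFree B w x ρ d x∉B = from (pos (coincidence B w ρ (upd M ρ x d) (agree-notFree B x d ρ _ x∉B λ _ → refl)))

  ⇒-elim : ∀ {w x ρ} A B → I⁺ M w ρ (A ⇒ B) → w ≼ x → I⁺ M x ρ A → I⁺ M x ρ B
  ⇒-elim {x = x} A B h w≼x a with h x w≼x
  ... | inj₁ ¬a = ⊥-elim (¬a a)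
  ... | inj₂ b  = b

  module Soundness (em : ExcludedMiddle 0ℓ) where

    ⇒-intro : ∀ {w ρ} A B → (∀ x → w ≼ x → I⁺ M x ρ A → I⁺ M x ρ B) → I⁺ M w ρ (A ⇒ B)
    ⇒-intro {ρ = ρ} A B f x w≼x with em {I⁺ M x ρ A}
    ... | yes a = inj₂ (f x w≼x a)
    ... | no ¬a = inj₁ ¬a

    ⇔ᶠ-intro : ∀ {w ρ} A B → (∀ x → I⁺ M x ρ A → I⁺ M x ρ B) → (∀ x → I⁺ M x ρ B → I⁺ M x ρ A) →
               I⁺ M w ρ (A ⇔ᶠ B)
    ⇔ᶠ-intro A B f g = ⇒-intro A B (λ x _ → f x) , ⇒-intro B A (λ x _ → g x)

    Axiom-valid : ∀ {A} → Axiom A → ∀ w ρ → InDomain w ρ → I⁺ M w ρ A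
    Axiom-valid (ax1 A B) w ρ _ = ⇒-intro A (B ⇒ A) λ x _ a → ⇒-intro B A λ y x≼y _ → I⁺-mono A ρ x≼y a
    Axiom-valid (ax2 A B C) w ρ _ =
      ⇒-intro (A ⇒ (B ⇒ C)) ((A ⇒ B) ⇒ (A ⇒ C)) λ x _ f →
      ⇒-intro (A ⇒ B) (A ⇒ C) λ y x≼y g →
      ⇒-intro A C λ z y≼z a →
        ⇒-elim B C (⇒-elim A (B ⇒ C) f (≼-trans x≼y y≼z) a) ≼-refl (⇒-elim A B g y≼z a)
    Axiom-valid (ax4 A B) w ρ _ = ⇒-intro (A ∧ᶠ B) A λ _ _ → proj₁
    Axiom-valid (ax5 A B) w ρ _ = ⇒-intro (A ∧ᶠ B) B λ _ _ → proj₂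
    Axiom-valid (ax6 A B C) w ρ _ =
      ⇒-intro (C ⇒ A) ((C ⇒ B) ⇒ (C ⇒ (A ∧ᶠ B))) λ x _ f →
      ⇒-intro (C ⇒ B) (C ⇒ (A ∧ᶠ B)) λ y x≼y g →
      ⇒-intro C (A ∧ᶠ B) λ z y≼z c →
        ⇒-elim C A f (≼-trans x≼y y≼z) c , ⇒-elim C B g y≼z c
    Axiom-valid (ax7 A B) w ρ _ = ⇒-intro A (A ∨ᶠ B) λ _ _ → inj₁
    Axiom-valid (ax8 A B) w ρ _ = ⇒-intro B (A ∨ᶠ B) λ _ _ → inj₂
    Axiom-valid (ax9 A B C) w ρ _ =
      ⇒-intro (A ⇒ C) ((B ⇒ C) ⇒ ((A ∨ᶠ B) ⇒ C)) λ x _ f →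
      ⇒-intro (B ⇒ C) ((A ∨ᶠ B) ⇒ C) λ y x≼y g →
      ⇒-intro (A ∨ᶠ B) C
        λ { z y≼z (inj₁ a) → ⇒-elim A C f (≼-trans x≼y y≼z) a
          ; z y≼z (inj₂ b) → ⇒-elim B C g y≼z b }
    Axiom-valid (ax10 A) w ρ _ = ⇒-intro ⊥ᶠ A λ _ _ ()
    Axiom-valid (ax11 A x t ff) w ρ ρ∈w = ⇒-intro (sub t x A) (∃ᶠ x A) λ y w≼y a →
      evalT M ρ t , evalT-InDomain t (InDomain-mono w≼y ρ∈w) , to (pos (substitution A t x ff y ρ _ λ _ → refl)) a
    Axiom-valid (ax12 A B x x∉B) w ρ _ = ⇒-intro (∀ᶠ x (A ⇒ B)) (∃ᶠ x A ⇒ B) λ y _ h → ⇒-intro (∃ᶠ x A) B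
      λ { z y≼z (d , dz , a) → upd-notFree B z x ρ d x∉B (⇒-elim A B (h z y≼z d dz) ≼-refl a) }
    Axiom-valid (ax13 A B x x∉B) w ρ _ = ⇒-intro (∀ᶠ x (B ⇒ A)) (B ⇒ ∀ᶠ x A) λ y _ h → ⇒-intro B (∀ᶠ x A)
      λ z y≼z b u z≼u d du → ⇒-elim B A (h u (≼-trans y≼z z≼u) d du) ≼-refl
        (to (pos (coincidence B u ρ _ (agree-notFree B x d ρ _ x∉B λ _ → refl))) (I⁺-mono B ρ z≼u b))
    Axiom-valid (ax14 A x t ff) w ρ ρ∈w = ⇒-intro (∀ᶠ x A) (sub t x A) λ y w≼y h →
      from (pos (substitution A t x ff y ρ _ λ _ → refl))
           (h y ≼-refl (evalT M ρ t) (evalT-InDomain t (InDomain-mono w≼y ρ∈w)))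
    Axiom-valid (ax15 A) w ρ _ = ⇒-intro A (∼ ⊥ᶠ) λ _ _ _ → tt
    Axiom-valid (ax16 A)   w ρ _ = ⇔ᶠ-intro (∼ ∼ A) A (λ _ a → a) (λ _ a → a)
    Axiom-valid (ax17 A B) w ρ _ = ⇔ᶠ-intro (∼ (A ∧ᶠ B)) (∼ A ∨ᶠ ∼ B) (λ _ a → a) (λ _ a → a)
    Axiom-valid (ax18 A B) w ρ _ = ⇔ᶠ-intro (∼ (A ∨ᶠ B)) (∼ A ∧ᶠ ∼ B) (λ _ a → a) (λ _ a → a)
    Axiom-valid (ax19 A B) w ρ _ = ⇔ᶠ-intro (∼ (A ⇒ B)) (¬ᶠ (∼ A) ∧ᶠ ∼ B)
      (λ { _ (f , b) → (λ y x≼y → inj₁ (f y x≼y)) , b })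
      (λ { _ (g , b) → (λ y x≼y a → [ (λ ¬a → ¬a a) , (λ ()) ] (g y x≼y)) , b })
    Axiom-valid (ax20 A x) w ρ _ = ⇔ᶠ-intro (∼ ∀ᶠ x A) (∃ᶠ x (∼ A)) (λ _ a → a) (λ _ a → a)
    Axiom-valid (ax21 A x) w ρ _ = ⇔ᶠ-intro (∼ ∃ᶠ x A) (∀ᶠ x (∼ A)) (λ _ a → a) (λ _ a → a)

    -- Hypotheses are required to hold at every later world under every environment,
    -- as they do for sentences true at w.
    soundness : ∀ {Γ A} → Γ ⊢ᵢ A → ∀ w ρ → InDomain w ρ →
                (∀ {B} → Γ B → ∀ x → w ≼ x → ∀ ρ' → I⁺ M x ρ' B) → I⁺ M w ρ A
    soundness (hyp h)       w ρ ρ∈w Γ⊨ = Γ⊨ h w ≼-refl ρ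
    soundness (ax a)        w ρ ρ∈w Γ⊨ = Axiom-valid a w ρ ρ∈w
    soundness (mp {A} {B} d e) w ρ ρ∈w Γ⊨ = ⇒-elim A B (soundness e w ρ ρ∈w Γ⊨) ≼-refl (soundness d w ρ ρ∈w Γ⊨)
    soundness (gen x d)     w ρ ρ∈w Γ⊨ y w≼y e ey =
      soundness d y (upd M ρ x e) (InDomain-upd x e (InDomain-mono w≼y ρ∈w) ey) λ h z y≼z → Γ⊨ h z (≼-trans w≼y y≼z)

-- Pairing and an enumeration of formulas

private
  next : ℕ × ℕ → ℕ × ℕ
  next (a , zero)  = 0 , suc a
  next (a , suc b) = suc a , b

unpair : ℕ → ℕ × ℕ
unpair zero    = 0 , 0
unpair (suc n) = next (unpair n)

private
  Reached : ℕ × ℕ → Set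
  Reached p = Σ ℕ λ n → unpair n ≡ p

  reached-diagonal : ∀ a b → Reached (0 , a + b) → Reached (a , b)
  reached-diagonal zero    b r = r
  reached-diagonal (suc a) b r with reached-diagonal a (suc b) (subst (λ m → Reached (0 , m)) (sym (+-suc a b)) r)
  ... | n , e = suc n , cong next e

  reached-diagonal-start : ∀ m → Reached (0 , m)
  reached-diagonal-start zero    = 0 , refl
  reached-diagonal-start (suc m)
    with reached-diagonal m 0 (subst (λ k → Reached (0 , k)) (sym (+-identityʳ m)) (reached-diagonal-start m))
  ... | n , e = suc n , cong next e

unpair-surjective : ∀ a b → Σ ℕ λ n → unpair n ≡ (a , b)
unpair-surjective a b = reached-diagonal a b (reached-diagonal-start (a + b))

unpair-sum : ∀ n → proj₁ (unpair n) + proj₂ (unpair n) ≤ n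
unpair-sum zero    = z≤n
unpair-sum (suc n) = ≤-trans (next-sum (unpair n)) (s≤s (unpair-sum n))
  where
  next-sum : ∀ p → proj₁ (next p) + proj₂ (next p) ≤ suc (proj₁ p + proj₂ p)
  next-sum (a , zero)  = s≤s (m≤m+n a 0)
  next-sum (a , suc b) = s≤s (subst (a + b ≤_) (sym (+-suc a b)) (n≤1+n _))

-- Kept abstract: normalising a concrete pair is prohibitively slow.
abstract
  pair : ℕ → ℕ → ℕ
  pair a b = proj₁ (unpair-surjective a b)

  unpair-pair : ∀ a b → unpair (pair a b) ≡ (a , b)
  unpair-pair a b = proj₂ (unpair-surjective a b)

pair-≥ : ∀ a b → b ≤ pair a b
pair-≥ a b = ≤-trans (m≤n+m b a) (subst (λ p → proj₁ p + proj₂ p ≤ pair a b) (unpair-pair a b) (unpair-sum (pair a b)))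

private
  fst snd : ℕ → ℕ
  fst r = proj₁ (unpair r)
  snd r = proj₂ (unpair r)

decodeT : ℕ → Term
decodeT r = tagged (unpair r)
  where
  tagged : ℕ × ℕ → Term
  tagged (zero  , x) = var x
  tagged (suc _ , c) = con c

decodeTs : (n : ℕ) → ℕ → Vec Term n
decodeTs zero    _ = []
decodeTs (suc n) r = decodeT (fst r) ∷ decodeTs n (snd r)

decodeNode : ℕ → (ℕ → Form) → ℕ → Form
decodeNode 0 dec r = ⊥ᶠ
decodeNode 1 dec r = ∼ dec r
decodeNode 2 dec r = dec (fst r) ∧ᶠ dec (snd r)
decodeNode 3 dec r = dec (fst r) ∨ᶠ dec (snd r)
decodeNode 4 dec r = dec (fst r) ⇒ dec (snd r)
decodeNode 5 dec r = ∀ᶠ (fst r) (dec (snd r))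
decodeNode 6 dec r = ∃ᶠ (fst r) (dec (snd r))
decodeNode (suc (suc (suc (suc (suc (suc (suc _))))))) dec r =
  pred (fst r) (fst (snd r)) (decodeTs (fst r) (snd (snd r)))

-- the first argument is fuel
decode : ℕ → ℕ → Form
decode zero    m = ⊥ᶠ
decode (suc f) m = decodeNode (fst m) (decode f) (snd m)

encodeT : Term → ℕ
encodeT (var x) = pair 0 x
encodeT (con c) = pair 1 c

encodeTs : ∀ {n} → Vec Term n → ℕ
encodeTs []       = 0
encodeTs (u ∷ us) = pair (encodeT u) (encodeTs us)

encode : Form → ℕ
encode (pred n k ts) = pair 7 (pair n (pair k (encodeTs ts)))
encode ⊥ᶠ       = pair 0 0
encode (∼ A)    = pair 1 (encode A)
encode (A ∧ᶠ B) = pair 2 (pair (encode A) (encode B))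
encode (A ∨ᶠ B) = pair 3 (pair (encode A) (encode B))
encode (A ⇒ B)  = pair 4 (pair (encode A) (encode B))
encode (∀ᶠ y A) = pair 5 (pair y (encode A))
encode (∃ᶠ y A) = pair 6 (pair y (encode A))

depth : Form → ℕ
depth (pred n k ts) = 0
depth ⊥ᶠ       = 0
depth (∼ A)    = suc (depth A)
depth (A ∧ᶠ B) = suc (depth A ⊔ depth B)
depth (A ∨ᶠ B) = suc (depth A ⊔ depth B)
depth (A ⇒ B)  = suc (depth A ⊔ depth B)
depth (∀ᶠ y A) = suc (depth A)
depth (∃ᶠ y A) = suc (depth A)

decodeT-encodeT : ∀ u → decodeT (encodeT u) ≡ u
decodeT-encodeT (var x) rewrite unpair-pair 0 x = refl
decodeT-encodeT (con c) rewrite unpair-pair 1 c = refl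

decodeTs-encodeTs : ∀ {n} (us : Vec Term n) → decodeTs n (encodeTs us) ≡ us
decodeTs-encodeTs []       = refl
decodeTs-encodeTs (u ∷ us) rewrite unpair-pair (encodeT u) (encodeTs us) =
  cong₂ _∷_ (decodeT-encodeT u) (decodeTs-encodeTs us)

decode-encode : ∀ A {f} → depth A < f → decode f (encode A) ≡ A
decode-encode (pred n k ts) {suc f} _
  rewrite unpair-pair 7 (pair n (pair k (encodeTs ts))) | unpair-pair n (pair k (encodeTs ts)) | unpair-pair k (encodeTs ts)
  = cong (pred n k) (decodeTs-encodeTs ts)
decode-encode ⊥ᶠ {suc f} _ rewrite unpair-pair 0 0 = refl
decode-encode (∼ A) {suc f} (s≤s lt) rewrite unpair-pair 1 (encode A) = cong ∼_ (decode-encode A lt)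
decode-encode (A ∧ᶠ B) {suc f} (s≤s lt) rewrite unpair-pair 2 (pair (encode A) (encode B)) | unpair-pair (encode A) (encode B) =
  cong₂ _∧ᶠ_ (decode-encode A (≤-trans (s≤s (m≤m⊔n _ _)) lt)) (decode-encode B (≤-trans (s≤s (m≤n⊔m _ _)) lt))
decode-encode (A ∨ᶠ B) {suc f} (s≤s lt) rewrite unpair-pair 3 (pair (encode A) (encode B)) | unpair-pair (encode A) (encode B) =
  cong₂ _∨ᶠ_ (decode-encode A (≤-trans (s≤s (m≤m⊔n _ _)) lt)) (decode-encode B (≤-trans (s≤s (m≤n⊔m _ _)) lt))
decode-encode (A ⇒ B) {suc f} (s≤s lt) rewrite unpair-pair 4 (pair (encode A) (encode B)) | unpair-pair (encode A) (encode B) =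
  cong₂ _⇒_ (decode-encode A (≤-trans (s≤s (m≤m⊔n _ _)) lt)) (decode-encode B (≤-trans (s≤s (m≤n⊔m _ _)) lt))
decode-encode (∀ᶠ y A) {suc f} (s≤s lt) rewrite unpair-pair 5 (pair y (encode A)) | unpair-pair y (encode A) =
  cong (∀ᶠ y) (decode-encode A lt)
decode-encode (∃ᶠ y A) {suc f} (s≤s lt) rewrite unpair-pair 6 (pair y (encode A)) | unpair-pair y (encode A) =
  cong (∃ᶠ y) (decode-encode A lt)

enum : ℕ → Form
enum n = decode (fst n) (snd n)

enum-surjective : ∀ A → Σ ℕ λ n → enum n ≡ A
enum-surjective A = pair (suc (depth A)) (encode A) , enumerates
  where
  enumerates : enum (pair (suc (depth A)) (encode A)) ≡ A
  enumerates rewrite unpair-pair (suc (depth A)) (encode A) = decode-encode A ≤-refl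

-- The constant 2c stands for the original constant c, the constant 2e+1 for the e-th new
-- constant; the new constant e is first available at level 1 + proj₁ (unpair e).

double : ℕ → ℕ
double zero    = zero
double (suc c) = suc (suc (double c))

half : ℕ → ℕ
half zero          = zero
half (suc zero)    = zero
half (suc (suc x)) = suc (half x)

half-double : ∀ c → half (double c) ≡ c
half-double zero    = refl
half-double (suc c) = cong suc (half-double c)

double-≥ : ∀ c → c ≤ double c
double-≥ zero    = z≤n
double-≥ (suc c) = s≤s (m≤n⇒m≤1+n (double-≥ c))

Elemᶜ : Set
Elemᶜ = ℕ ⊎ ℕ

conCode : Elemᶜ → Con
conCode (inj₁ c) = double c
conCode (inj₂ e) = suc (double e)

conDecode : Con → Elemᶜ
conDecode zero          = inj₁ zero
conDecode (suc zero)    = inj₂ zero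
conDecode (suc (suc x)) = ⊎-map suc suc (conDecode x)

conDecode-conCode : ∀ d → conDecode (conCode d) ≡ d
conDecode-conCode (inj₁ zero)    = refl
conDecode-conCode (inj₁ (suc c)) = cong (⊎-map suc suc) (conDecode-conCode (inj₁ c))
conDecode-conCode (inj₂ zero)    = refl
conDecode-conCode (inj₂ (suc e)) = cong (⊎-map suc suc) (conDecode-conCode (inj₂ e))

conCode-conDecode : ∀ x → conCode (conDecode x) ≡ x
conCode-conDecode zero          = refl
conCode-conDecode (suc zero)    = refl
conCode-conDecode (suc (suc x)) = trans (code-suc (conDecode x)) (cong (suc ∘ suc) (conCode-conDecode x))
  where
  code-suc : ∀ d → conCode (⊎-map suc suc d) ≡ suc (suc (conCode d))
  code-suc (inj₁ c) = refl
  code-suc (inj₂ e) = refl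

InLevel : ℕ → Elemᶜ → Set
InLevel k (inj₁ _) = ⊤
InLevel k (inj₂ e) = fst e < k

InLevel-mono : ∀ {k k'} → k ≤ k' → ∀ d → InLevel k d → InLevel k' d
InLevel-mono k≤k' (inj₁ _) _ = tt
InLevel-mono k≤k' (inj₂ e) e<k = ≤-trans e<k k≤k'

InL : ℕ → Con → Set
InL k c = InLevel k (conDecode c)

InL-conCode : ∀ k d → InLevel k d → InL k (conCode d)
InL-conCode k d d∈k = subst (InLevel k) (sym (conDecode-conCode d)) d∈k

newCon : ℕ → ℕ → Con
newCon k j = conCode (inj₂ (pair k j))

newCon-∉ : ∀ k j → ¬ InL k (newCon k j)
newCon-∉ k j rewrite conDecode-conCode (inj₂ (pair k j)) | unpair-pair k j = <-irrefl refl

newCon-∈ : ∀ k j → InL (suc k) (newCon k j)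
newCon-∈ k j rewrite conDecode-conCode (inj₂ (pair k j)) | unpair-pair k j = ≤-refl

newCon-≥ : ∀ k j → j ≤ newCon k j
newCon-≥ k j = m≤n⇒m≤1+n (≤-trans (pair-≥ k j) (double-≥ _))

LSent : ℕ → Form → Set
LSent k φ = Sentence φ × AllCon (InL k) φ

LSent-mono : ∀ {k k'} → k ≤ k' → ∀ φ → LSent k φ → LSent k' φ
LSent-mono k≤k' φ (s , a) = s , AllCon-mono (λ {c} → InLevel-mono k≤k' (conDecode c)) φ a

LSent-∧ : ∀ {k φ ψ} → LSent k φ → LSent k ψ → LSent k (φ ∧ᶠ ψ)
LSent-∧ (s , a) (s' , a') = (λ v → cong₂ _∨_ (s v) (s' v)) , a , a'

LSent-∨ : ∀ {k φ ψ} → LSent k φ → LSent k ψ → LSent k (φ ∨ᶠ ψ)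
LSent-∨ (s , a) (s' , a') = (λ v → cong₂ _∨_ (s v) (s' v)) , a , a'

LSent-⇒ : ∀ {k φ ψ} → LSent k φ → LSent k ψ → LSent k (φ ⇒ ψ)
LSent-⇒ (s , a) (s' , a') = (λ v → cong₂ _∨_ (s v) (s' v)) , a , a'

LSent-∨⁻ : ∀ {k φ ψ} → LSent k (φ ∨ᶠ ψ) → LSent k φ × LSent k ψ
LSent-∨⁻ (s , a , a') = ((λ v → ∨-conicalˡ _ _ (s v)) , a) , ((λ v → ∨-conicalʳ _ _ (s v)) , a')

witness : Con → Form → Form
witness c (∃ᶠ x X) = sub (con c) x X
witness c φ        = φ

data WitnessView (c : Con) : Form → Form → Set where
  ∃-witness  : ∀ x X → WitnessView c (∃ᶠ x X) (sub (con c) x X)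
  no-witness : ∀ φ → WitnessView c φ φ

witness-view : ∀ c φ → WitnessView c φ (witness c φ)
witness-view c (pred n k ts) = no-witness _
witness-view c ⊥ᶠ       = no-witness _
witness-view c (∼ A)    = no-witness _
witness-view c (A ∧ᶠ B) = no-witness _
witness-view c (A ∨ᶠ B) = no-witness _
witness-view c (A ⇒ B)  = no-witness _
witness-view c (∀ᶠ y A) = no-witness _
witness-view c (∃ᶠ y A) = ∃-witness y A

-- From S, ∃x X, X(c) ⊢ C get S, ∃x X ⊢ X(c) → C, generalise on the fresh c and apply Ax12.
witness-conservative : ∀ {S C φ} c → Sentence C → Sentence φ →
                       (∀ {ψ} → S ψ → Fresh c ψ) → Fresh c φ → Fresh c C →
                       S ,, φ ,, witness c φ ⊢ᵢ C → S ,, φ ⊢ᵢ C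
witness-conservative {S} {C} {φ} c C-sent φ-sent S-fresh φ-fresh C-fresh d with witness c φ | witness-view c φ
... | _ | no-witness _ = weaken [ id , inj₂ ] d
... | _ | ∃-witness x X = mp here (mp ∀x[X⇒C] (ax (ax12 X C x (C-sent x))))
  where
  T : Pred Form 0ℓ
  T = S ,, ∃ᶠ x X
  X[c]⇒C : T ⊢ᵢ sub (con c) x (X ⇒ C)
  X[c]⇒C = subst (λ F → T ⊢ᵢ sub (con c) x X ⇒ F) (sym (sub-notFree (con c) x C (C-sent x)))
                 (deduction (sentence-sub-con c x X φ-sent) d)
  T-fresh : ∀ {ψ} → T ψ → Fresh c ψ
  T-fresh (inj₁ h)    = S-fresh h
  T-fresh (inj₂ refl) = φ-fresh
  ∀x[X⇒C] : T ⊢ᵢ ∀ᶠ x (X ⇒ C)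
  ∀x[X⇒C] = gen-con c x (X ⇒ C) T-fresh (φ-fresh , C-fresh) X[c]⇒C

AllCon-witness : ∀ {P} c φ → P c → AllCon P φ → AllCon P (witness c φ)
AllCon-witness c φ pc a with witness c φ | witness-view c φ
... | _ | no-witness _  = a
... | _ | ∃-witness x X = AllCon-sub c x X pc a

LSent-witness : ∀ {k} c φ → InL k c → LSent k φ → LSent k (witness c φ)
LSent-witness c φ c∈L (s , a) with witness c φ | witness-view c φ
... | _ | no-witness _  = s , a
... | _ | ∃-witness x X = sentence-sub-con c x X s , AllCon-sub c x X c∈L a

-- Prime saturated theories

record World (k : ℕ) : Set₁ where
  field
    theory     : Pred Form 0ℓ
    lang       : ∀ {φ} → theory φ → LSent k φ
    closed     : ∀ {φ} → LSent k φ → theory ⊢ᵢ φ → theory φ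
    prime      : ∀ {φ ψ} → theory (φ ∨ᶠ ψ) → theory φ ⊎ theory ψ
    consistent : ¬ theory ⊥ᶠ
    witnessed  : ∀ {x X} → theory (∃ᶠ x X) → Σ Con λ c → InL k c × theory (sub (con c) x X)

module Lindenbaum (em : ExcludedMiddle 0ℓ) (k : ℕ) (Δ : Pred Form 0ℓ) (B C : Form)
  (Δ-lang : ∀ {ψ} → Δ ψ → LSent k ψ) (B-lang : LSent k B) (C-sent : Sentence C) (Δ,B⊬C : ¬ (Δ ,, B ⊢ᵢ C)) where

  -- Stage n only uses constants of L k and constants below bound n.
  bound : ℕ → ℕ
  witnessCon : ℕ → Con

  bound zero    = conBound B ⊔ conBound C
  bound (suc n) = suc (witnessCon n)

  witnessCon n = newCon k (bound n ⊔ conBound (enum n))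

  Admissible : Pred Form 0ℓ → ℕ → Set
  Admissible S n = LSent (suc k) (enum n) × ¬ (S ,, enum n ⊢ᵢ C)

  extend : (S : Pred Form 0ℓ) (n : ℕ) → Dec (Admissible S n) → Pred Form 0ℓ
  extend S n (yes _) = S ,, enum n ,, witness (witnessCon n) (enum n)
  extend S n (no _)  = S

  stage : ℕ → Pred Form 0ℓ
  stage zero    = Δ ,, B
  stage (suc n) = extend (stage n) n em

  Θ : Pred Form 0ℓ
  Θ ψ = Σ ℕ λ n → stage n ψ

  extend-⊇ : ∀ S n d → S ⊆ extend S n d
  extend-⊇ S n (yes _) h = inj₁ (inj₁ h)
  extend-⊇ S n (no _)  h = h

  stage-mono : ∀ {m n} → m ≤′ n → stage m ⊆ stage n
  stage-mono (≤′-reflexive refl) h = h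
  stage-mono (≤′-step m≤′n)      h = extend-⊇ _ _ em (stage-mono m≤′n h)

  enum-≤-witnessCon : ∀ n → conBound (enum n) ≤ witnessCon n
  enum-≤-witnessCon n = ≤-trans (m≤n⊔m (bound n) _) (newCon-≥ k _)

  bound-≤-witnessCon : ∀ n → bound n ≤ witnessCon n
  bound-≤-witnessCon n = ≤-trans (m≤m⊔n _ (conBound (enum n))) (newCon-≥ k _)

  bound-≥ : ∀ n → bound 0 ≤ bound n
  bound-≥ zero    = ≤-refl
  bound-≥ (suc n) = ≤-trans (bound-≥ n) (m≤n⇒m≤1+n (bound-≤-witnessCon n))

  Bounded : ℕ → Form → Set
  Bounded n = AllCon (λ c → InL k c ⊎ c < bound n)

  Bounded-suc : ∀ {n} ψ → Bounded n ψ → Bounded (suc n) ψ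
  Bounded-suc {n} = AllCon-mono {λ c → InL k c ⊎ c < bound n}
    [ inj₁ , (λ c<b → inj₂ (≤-trans c<b (m≤n⇒m≤1+n (bound-≤-witnessCon n)))) ]

  enum-Bounded : ∀ n → Bounded (suc n) (enum n)
  enum-Bounded n = AllCon-mono inj₂ (enum n) (AllCon-conBound (enum n) (m≤n⇒m≤1+n (enum-≤-witnessCon n)))

  witness-Bounded : ∀ n → Bounded (suc n) (witness (witnessCon n) (enum n))
  witness-Bounded n = AllCon-witness _ (enum n) (inj₂ ≤-refl) (enum-Bounded n)

  stage-Bounded : ∀ n {ψ} → stage n ψ → Bounded n ψ
  stage-Bounded zero    {ψ} (inj₁ h) = AllCon-mono inj₁ ψ (proj₂ (Δ-lang h))
  stage-Bounded zero    (inj₂ refl)  = AllCon-mono inj₂ B (AllCon-conBound B (m≤m⊔n _ _))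
  stage-Bounded (suc n) h = bounded (em {Admissible (stage n) n}) h
    where
    bounded : ∀ d {ψ} → extend (stage n) n d ψ → Bounded (suc n) ψ
    bounded (no _)  {ψ} h               = Bounded-suc {n} ψ (stage-Bounded n h)
    bounded (yes _) {ψ} (inj₁ (inj₁ h)) = Bounded-suc {n} ψ (stage-Bounded n h)
    bounded (yes _) (inj₁ (inj₂ refl))  = enum-Bounded n
    bounded (yes _) (inj₂ refl)         = witness-Bounded n

  Bounded⇒Fresh : ∀ {n c} ψ → ¬ InL k c → bound n ≤ c → Bounded n ψ → Fresh c ψ
  Bounded⇒Fresh ψ c∉L b≤c =
    AllCon-mono [ (λ { c'∈L refl → c∉L c'∈L }) , (λ { c'<b refl → <-irrefl refl (≤-trans c'<b b≤c) }) ] ψ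

  witnessCon-fresh : ∀ n {ψ} → stage n ψ → Fresh (witnessCon n) ψ
  witnessCon-fresh n {ψ} h = Bounded⇒Fresh {n} ψ (newCon-∉ k _) (bound-≤-witnessCon n) (stage-Bounded n h)

  stage-consistent : ∀ n → ¬ (stage n ⊢ᵢ C)
  stage-consistent zero    = Δ,B⊬C
  stage-consistent (suc n) = consistent em
    where
    consistent : ∀ d → ¬ (extend (stage n) n d ⊢ᵢ C)
    consistent (no _)                     = stage-consistent n
    consistent (yes (φ-lang , S,φ⊬C)) d = S,φ⊬C
      (witness-conservative (witnessCon n) C-sent (proj₁ φ-lang) (witnessCon-fresh n)
         (conBound⇒Fresh (enum n) (enum-≤-witnessCon n))
         (conBound⇒Fresh C (≤-trans (m≤n⊔m _ _) (≤-trans (bound-≥ n) (bound-≤-witnessCon n)))) d)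

  compact : ∀ {ψ} → Θ ⊢ᵢ ψ → Σ ℕ λ n → stage n ⊢ᵢ ψ
  compact (hyp (n , h)) = n , hyp h
  compact (ax a)        = 0 , ax a
  compact (mp d e) with compact d | compact e
  ... | m , d' | n , e' =
    m ⊔ n , mp (weaken (stage-mono (≤⇒≤′ (m≤m⊔n m n))) d') (weaken (stage-mono (≤⇒≤′ (m≤n⊔m m n))) e')
  compact (gen x d) with compact d
  ... | n , d' = n , gen x d'

  Θ-consistent : ¬ (Θ ⊢ᵢ C)
  Θ-consistent d with compact d
  ... | n , d' = stage-consistent n d'

  stage-lang : ∀ n {ψ} → stage n ψ → LSent (suc k) ψ
  stage-lang zero    {ψ} (inj₁ h)    = LSent-mono (n≤1+n k) ψ (Δ-lang h)
  stage-lang zero        (inj₂ refl) = LSent-mono (n≤1+n k) B B-lang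
  stage-lang (suc n) = lang em
    where
    lang : ∀ d {ψ} → extend (stage n) n d ψ → LSent (suc k) ψ
    lang (no _)             h                = stage-lang n h
    lang (yes _)            (inj₁ (inj₁ h))  = stage-lang n h
    lang (yes (φ-lang , _)) (inj₁ (inj₂ refl)) = φ-lang
    lang (yes (φ-lang , _)) (inj₂ refl)      = LSent-witness _ (enum n) (newCon-∈ k _) φ-lang

  Θ-lang : ∀ {ψ} → Θ ψ → LSent (suc k) ψ
  Θ-lang (n , h) = stage-lang n h

  admitted : ∀ n → Admissible (stage n) n → stage (suc n) (enum n) × stage (suc n) (witness (witnessCon n) (enum n))
  admitted n adm = admitted′ em
    where
    admitted′ : ∀ d → extend (stage n) n d (enum n) × extend (stage n) n d (witness (witnessCon n) (enum n))
    admitted′ (yes _)   = inj₁ (inj₂ refl) , inj₂ refl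
    admitted′ (no ¬adm) = ⊥-elim (¬adm adm)

  rejected : ∀ {φ} → LSent (suc k) φ → ¬ Θ φ → Θ ,, φ ⊢ᵢ C
  rejected {φ} φ-lang φ∉Θ with enum-surjective φ
  ... | n , refl with em {stage n ,, enum n ⊢ᵢ C}
  ...   | yes d  = weaken [ (λ h → inj₁ (n , h)) , inj₂ ] d
  ...   | no S⊬C = ⊥-elim (φ∉Θ (suc n , proj₁ (admitted n (φ-lang , S⊬C))))

  closed : ∀ {φ} → LSent (suc k) φ → Θ ⊢ᵢ φ → Θ φ
  closed {φ} φ-lang d with em {Θ φ}
  ... | yes φ∈Θ = φ∈Θ
  ... | no φ∉Θ  = ⊥-elim (Θ-consistent (cut d (rejected φ-lang φ∉Θ)))

  prime : ∀ {φ ψ} → Θ (φ ∨ᶠ ψ) → Θ φ ⊎ Θ ψ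
  prime {φ} {ψ} h with em {Θ φ} | em {Θ ψ} | LSent-∨⁻ {φ = φ} {ψ} (Θ-lang {φ ∨ᶠ ψ} h)
  ... | yes φ∈Θ | _       | _ = inj₁ φ∈Θ
  ... | no _    | yes ψ∈Θ | _ = inj₂ ψ∈Θ
  ... | no φ∉Θ  | no ψ∉Θ  | φ-lang , ψ-lang = ⊥-elim (Θ-consistent
    (∨-elim (hyp h) (deduction (proj₁ φ-lang) (rejected {φ} φ-lang φ∉Θ))
                    (deduction (proj₁ ψ-lang) (rejected {ψ} ψ-lang ψ∉Θ))))

  witnessed : ∀ {x X} → Θ (∃ᶠ x X) → Σ Con λ c → InL (suc k) c × Θ (sub (con c) x X)
  witnessed {x} {X} (m , h) with enum-surjective (∃ᶠ x X)
  ... | n , e = witnessCon n , newCon-∈ k _ ,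
                (suc n , subst (λ φ → stage (suc n) (witness (witnessCon n) φ)) e (proj₂ (admitted n adm)))
    where
    adm : Admissible (stage n) n
    adm = subst (LSent (suc k)) (sym e) (stage-lang m h) ,
          λ d → Θ-consistent (cut (hyp (m , h)) (weaken [ (λ h → inj₁ (n , h)) , (λ eq → inj₂ (trans (sym e) eq)) ] d))

  world : World (suc k)
  world = record
    { theory     = Θ
    ; lang       = Θ-lang
    ; closed     = closed
    ; prime      = prime
    ; consistent = λ ⊥∈Θ → Θ-consistent (mp (hyp ⊥∈Θ) (ax (ax10 C)))
    ; witnessed  = witnessed
    }

lindenbaum : ExcludedMiddle 0ℓ → ∀ k {Δ B C} → (∀ {ψ} → Δ ψ → LSent k ψ) → LSent k B → Sentence C →
             ¬ (Δ ,, B ⊢ᵢ C) → Σ (World (suc k)) λ W → Δ ⊆ World.theory W × World.theory W B × ¬ World.theory W C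
lindenbaum em k {Δ} {B} {C} Δ-lang B-lang C-sent Δ,B⊬C =
  world , (λ h → 0 , inj₁ h) , (0 , inj₂ refl) , (λ C∈Θ → Θ-consistent (hyp C∈Θ))
  where open Lindenbaum em k Δ B C Δ-lang B-lang C-sent Δ,B⊬C

updT : (Var → Term) → Var → Term → Var → Term
updT σ y t v = if v ≡ᵇ y then t else σ v

instT : (Var → Term) → Term → Term
instT σ (var v) = σ v
instT σ (con c) = con (double c)

instTs : ∀ {n} → (Var → Term) → Vec Term n → Vec Term n
instTs σ []       = []
instTs σ (u ∷ us) = instT σ u ∷ instTs σ us

inst : (Var → Term) → Form → Form
inst σ (pred n k ts) = pred n k (instTs σ ts)
inst σ ⊥ᶠ       = ⊥ᶠ
inst σ (∼ A)    = ∼ inst σ A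
inst σ (A ∧ᶠ B) = inst σ A ∧ᶠ inst σ B
inst σ (A ∨ᶠ B) = inst σ A ∨ᶠ inst σ B
inst σ (A ⇒ B)  = inst σ A ⇒ inst σ B
inst σ (∀ᶠ y A) = ∀ᶠ y (inst (updT σ y (var y)) A)
inst σ (∃ᶠ y A) = ∃ᶠ y (inst (updT σ y (var y)) A)

updT-cong : ∀ {σ σ'} y t → (∀ v → σ v ≡ σ' v) → ∀ v → updT σ y t v ≡ updT σ' y t v
updT-cong y t σ≗σ' v with v ≡ᵇ y
... | true  = refl
... | false = σ≗σ' v

instTs-cong : ∀ {n σ σ'} → (∀ v → σ v ≡ σ' v) → (ts : Vec Term n) → instTs σ ts ≡ instTs σ' ts
instTs-cong σ≗σ' []           = refl
instTs-cong σ≗σ' (var v ∷ ts) = cong₂ _∷_ (σ≗σ' v) (instTs-cong σ≗σ' ts)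
instTs-cong σ≗σ' (con c ∷ ts) = cong (_ ∷_) (instTs-cong σ≗σ' ts)

inst-cong : ∀ {σ σ'} A → (∀ v → σ v ≡ σ' v) → inst σ A ≡ inst σ' A
inst-cong (pred n k ts) σ≗σ' = cong (pred n k) (instTs-cong σ≗σ' ts)
inst-cong ⊥ᶠ       σ≗σ' = refl
inst-cong (∼ A)    σ≗σ' = cong ∼_ (inst-cong A σ≗σ')
inst-cong (A ∧ᶠ B) σ≗σ' = cong₂ _∧ᶠ_ (inst-cong A σ≗σ') (inst-cong B σ≗σ')
inst-cong (A ∨ᶠ B) σ≗σ' = cong₂ _∨ᶠ_ (inst-cong A σ≗σ') (inst-cong B σ≗σ')
inst-cong (A ⇒ B)  σ≗σ' = cong₂ _⇒_ (inst-cong A σ≗σ') (inst-cong B σ≗σ')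
inst-cong (∀ᶠ y A) σ≗σ' = cong (∀ᶠ y) (inst-cong A (updT-cong y (var y) σ≗σ'))
inst-cong (∃ᶠ y A) σ≗σ' = cong (∃ᶠ y) (inst-cong A (updT-cong y (var y) σ≗σ'))

subTs-instTs : ∀ {n} σ t y (ts : Vec Term n) → subTs t y (instTs σ ts) ≡ instTs (λ v → subT t y (σ v)) ts
subTs-instTs σ t y []           = refl
subTs-instTs σ t y (var v ∷ ts) = cong (_ ∷_) (subTs-instTs σ t y ts)
subTs-instTs σ t y (con c ∷ ts) = cong (_ ∷_) (subTs-instTs σ t y ts)

private
  sub-inst-binder : ∀ σ y y' → (y ≡ᵇ y') ≡ false → (∀ v → (v ≡ᵇ y) ≡ false → occT y (σ v) ≡ false) →
                    ∀ v → (v ≡ᵇ y) ≡ false → occT y (updT σ y' (var y') v) ≡ false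
  sub-inst-binder σ y y' y≢y' σ-avoids v v≢y with v ≡ᵇ y'
  ... | true  = y≢y'
  ... | false = σ-avoids v v≢y

  subT-updT : ∀ σ t y y' → (y ≡ᵇ y') ≡ false →
              ∀ v → subT t y (updT σ y' (var y') v) ≡ updT (λ v → subT t y (σ v)) y' (var y') v
  subT-updT σ t y y' y≢y' v with v ≡ᵇ y'
  ... | true rewrite y≢y' = refl
  ... | false = refl

  updT-shadowed : ∀ σ t y y' → (y ≡ᵇ y') ≡ true → (∀ v → (v ≡ᵇ y) ≡ false → occT y (σ v) ≡ false) →
                  ∀ v → updT σ y' (var y') v ≡ updT (λ v → subT t y (σ v)) y' (var y') v
  updT-shadowed σ t y y' y≡y' σ-avoids v with v ≡ᵇ y' in v≡ᵇy'
  ... | true  = refl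
  ... | false = sym (subT-notOcc t y (σ v) (σ-avoids v (trans (cong (v ≡ᵇ_) (≡ᵇ-true⇒≡ y y' y≡y')) v≡ᵇy')))

sub-inst : ∀ A σ t y → (∀ v → (v ≡ᵇ y) ≡ false → occT y (σ v) ≡ false) →
           sub t y (inst σ A) ≡ inst (λ v → subT t y (σ v)) A
sub-inst (pred n k ts) σ t y σ-avoids = cong (pred n k) (subTs-instTs σ t y ts)
sub-inst ⊥ᶠ       σ t y σ-avoids = refl
sub-inst (∼ A)    σ t y σ-avoids = cong ∼_ (sub-inst A σ t y σ-avoids)
sub-inst (A ∧ᶠ B) σ t y σ-avoids = cong₂ _∧ᶠ_ (sub-inst A σ t y σ-avoids) (sub-inst B σ t y σ-avoids)
sub-inst (A ∨ᶠ B) σ t y σ-avoids = cong₂ _∨ᶠ_ (sub-inst A σ t y σ-avoids) (sub-inst B σ t y σ-avoids)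
sub-inst (A ⇒ B)  σ t y σ-avoids = cong₂ _⇒_ (sub-inst A σ t y σ-avoids) (sub-inst B σ t y σ-avoids)
sub-inst (∀ᶠ y' A) σ t y σ-avoids with y ≡ᵇ y' in y≡ᵇy'
... | true  = cong (∀ᶠ y') (inst-cong A (updT-shadowed σ t y y' y≡ᵇy' σ-avoids))
... | false = cong (∀ᶠ y') (trans (sub-inst A _ t y (sub-inst-binder σ y y' y≡ᵇy' σ-avoids))
                                  (inst-cong A (subT-updT σ t y y' y≡ᵇy')))
sub-inst (∃ᶠ y' A) σ t y σ-avoids with y ≡ᵇ y' in y≡ᵇy'
... | true  = cong (∃ᶠ y') (inst-cong A (updT-shadowed σ t y y' y≡ᵇy' σ-avoids))
... | false = cong (∃ᶠ y') (trans (sub-inst A _ t y (sub-inst-binder σ y y' y≡ᵇy' σ-avoids))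
                                  (inst-cong A (subT-updT σ t y y' y≡ᵇy')))

notFree-instTs : ∀ {n} v σ (ts : Vec Term n) → (∀ u → occT v (σ u) ≡ false) → occTs v (instTs σ ts) ≡ false
notFree-instTs v σ []           σ-closed = refl
notFree-instTs v σ (var u ∷ ts) σ-closed = cong₂ _∨_ (σ-closed u) (notFree-instTs v σ ts σ-closed)
notFree-instTs v σ (con c ∷ ts) σ-closed = notFree-instTs v σ ts σ-closed

notFree-inst : ∀ v σ A → (∀ u → occT v (σ u) ≡ false) → NotFree v (inst σ A)
notFree-inst v σ (pred n k ts) σ-closed = notFree-instTs v σ ts σ-closed
notFree-inst v σ ⊥ᶠ       σ-closed = refl
notFree-inst v σ (∼ A)    σ-closed = notFree-inst v σ A σ-closed
notFree-inst v σ (A ∧ᶠ B) σ-closed = cong₂ _∨_ (notFree-inst v σ A σ-closed) (notFree-inst v σ B σ-closed)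
notFree-inst v σ (A ∨ᶠ B) σ-closed = cong₂ _∨_ (notFree-inst v σ A σ-closed) (notFree-inst v σ B σ-closed)
notFree-inst v σ (A ⇒ B)  σ-closed = cong₂ _∨_ (notFree-inst v σ A σ-closed) (notFree-inst v σ B σ-closed)
notFree-inst v σ (∀ᶠ y A) σ-closed with v ≡ᵇ y in v≡ᵇy
... | true  = refl
... | false = notFree-inst v _ A λ u → binder u
  where
  binder : ∀ u → occT v (updT σ y (var y) u) ≡ false
  binder u with u ≡ᵇ y
  ... | true  = v≡ᵇy
  ... | false = σ-closed u
notFree-inst v σ (∃ᶠ y A) σ-closed with v ≡ᵇ y in v≡ᵇy
... | true  = refl
... | false = notFree-inst v _ A λ u → binder u
  where
  binder : ∀ u → occT v (updT σ y (var y) u) ≡ false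
  binder u with u ≡ᵇ y
  ... | true  = v≡ᵇy
  ... | false = σ-closed u

InL-double : ∀ k c → InL k (double c)
InL-double k c = InL-conCode k (inj₁ c) tt

AllConTs-instTs : ∀ {n} k σ (ts : Vec Term n) → (∀ u → AllConT (InL k) (σ u)) → All (AllConT (InL k)) (instTs σ ts)
AllConTs-instTs k σ []           σ∈L = []
AllConTs-instTs k σ (var u ∷ ts) σ∈L = σ∈L u ∷ AllConTs-instTs k σ ts σ∈L
AllConTs-instTs k σ (con c ∷ ts) σ∈L = InL-double k c ∷ AllConTs-instTs k σ ts σ∈L

AllCon-inst : ∀ k σ A → (∀ u → AllConT (InL k) (σ u)) → AllCon (InL k) (inst σ A)
AllCon-inst k σ (pred n j ts) σ∈L = AllConTs-instTs k σ ts σ∈L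
AllCon-inst k σ ⊥ᶠ       σ∈L = tt
AllCon-inst k σ (∼ A)    σ∈L = AllCon-inst k σ A σ∈L
AllCon-inst k σ (A ∧ᶠ B) σ∈L = AllCon-inst k σ A σ∈L , AllCon-inst k σ B σ∈L
AllCon-inst k σ (A ∨ᶠ B) σ∈L = AllCon-inst k σ A σ∈L , AllCon-inst k σ B σ∈L
AllCon-inst k σ (A ⇒ B)  σ∈L = AllCon-inst k σ A σ∈L , AllCon-inst k σ B σ∈L
AllCon-inst k σ (∀ᶠ y A) σ∈L = AllCon-inst k _ A binder
  where
  binder : ∀ u → AllConT (InL k) (updT σ y (var y) u)
  binder u with u ≡ᵇ y
  ... | true  = tt
  ... | false = σ∈L u
AllCon-inst k σ (∃ᶠ y A) σ∈L = AllCon-inst k _ A binder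
  where
  binder : ∀ u → AllConT (InL k) (updT σ y (var y) u)
  binder u with u ≡ᵇ y
  ... | true  = tt
  ... | false = σ∈L u

instTs-id : ∀ {n} σ (ts : Vec Term n) → (∀ v → occTs v ts ≡ true → σ v ≡ var v) →
            instTs σ ts ≡ csubTs (con ∘ double) ts
instTs-id σ []           σ-id = refl
instTs-id σ (var u ∷ ts) σ-id =
  cong₂ _∷_ (σ-id u (∨-trueˡ _ (≡ᵇ-refl u))) (instTs-id σ ts λ v e → σ-id v (∨-trueʳ _ e))
instTs-id σ (con c ∷ ts) σ-id = cong (_ ∷_) (instTs-id σ ts λ v e → σ-id v (∨-trueʳ _ e))

inst-id : ∀ σ A → (∀ v → occursFree v A ≡ true → σ v ≡ var v) → inst σ A ≡ csub (con ∘ double) A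
inst-id σ (pred n k ts) σ-id = cong (pred n k) (instTs-id σ ts σ-id)
inst-id σ ⊥ᶠ       σ-id = refl
inst-id σ (∼ A)    σ-id = cong ∼_ (inst-id σ A σ-id)
inst-id σ (A ∧ᶠ B) σ-id =
  cong₂ _∧ᶠ_ (inst-id σ A λ v e → σ-id v (∨-trueˡ _ e)) (inst-id σ B λ v e → σ-id v (∨-trueʳ _ e))
inst-id σ (A ∨ᶠ B) σ-id =
  cong₂ _∨ᶠ_ (inst-id σ A λ v e → σ-id v (∨-trueˡ _ e)) (inst-id σ B λ v e → σ-id v (∨-trueʳ _ e))
inst-id σ (A ⇒ B)  σ-id =
  cong₂ _⇒_ (inst-id σ A λ v e → σ-id v (∨-trueˡ _ e)) (inst-id σ B λ v e → σ-id v (∨-trueʳ _ e))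
inst-id σ (∀ᶠ y A) σ-id = cong (∀ᶠ y) (inst-id _ A binder)
  where
  binder : ∀ v → occursFree v A ≡ true → updT σ y (var y) v ≡ var v
  binder v e with v ≡ᵇ y in v≡ᵇy
  ... | true  = cong var (sym (≡ᵇ-true⇒≡ v y v≡ᵇy))
  ... | false = σ-id v (subst (λ b → (if b then false else occursFree v A) ≡ true) (sym v≡ᵇy) e)
inst-id σ (∃ᶠ y A) σ-id = cong (∃ᶠ y) (inst-id _ A binder)
  where
  binder : ∀ v → occursFree v A ≡ true → updT σ y (var y) v ≡ var v
  binder v e with v ≡ᵇ y in v≡ᵇy
  ... | true  = cong var (sym (≡ᵇ-true⇒≡ v y v≡ᵇy))
  ... | false = σ-id v (subst (λ b → (if b then false else occursFree v A) ≡ true) (sym v≡ᵇy) e)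

csubTs-inverse : ∀ {n} f g → (∀ c → f (g c) ≡ c) → (ts : Vec Term n) →
                 csubTs (con ∘ f) (csubTs (con ∘ g) ts) ≡ ts
csubTs-inverse f g fg []           = refl
csubTs-inverse f g fg (var x ∷ ts) = cong (_ ∷_) (csubTs-inverse f g fg ts)
csubTs-inverse f g fg (con c ∷ ts) = cong₂ _∷_ (cong con (fg c)) (csubTs-inverse f g fg ts)

csub-inverse : ∀ f g → (∀ c → f (g c) ≡ c) → ∀ A → csub (con ∘ f) (csub (con ∘ g) A) ≡ A
csub-inverse f g fg (pred n k ts) = cong (pred n k) (csubTs-inverse f g fg ts)
csub-inverse f g fg ⊥ᶠ       = refl
csub-inverse f g fg (∼ A)    = cong ∼_ (csub-inverse f g fg A)
csub-inverse f g fg (A ∧ᶠ B) = cong₂ _∧ᶠ_ (csub-inverse f g fg A) (csub-inverse f g fg B)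
csub-inverse f g fg (A ∨ᶠ B) = cong₂ _∨ᶠ_ (csub-inverse f g fg A) (csub-inverse f g fg B)
csub-inverse f g fg (A ⇒ B)  = cong₂ _⇒_ (csub-inverse f g fg A) (csub-inverse f g fg B)
csub-inverse f g fg (∀ᶠ y A) = cong (∀ᶠ y) (csub-inverse f g fg A)
csub-inverse f g fg (∃ᶠ y A) = cong (∃ᶠ y) (csub-inverse f g fg A)

-- The canonical model

-- A node lists the pairs (B , C) by which the base world has successively been extended.
Node : Set
Node = List (Form × Form)

infix 4 _≼_

_≼_ : Node → Node → Set
w ≼ x = Σ Node λ s → x ≡ s ++ w

≼-refl : ∀ {w} → w ≼ w
≼-refl = [] , refl

≼-trans : ∀ {w x y} → w ≼ x → x ≼ y → w ≼ y
≼-trans {w} (s , refl) (s' , refl) = s' ++ s , sym (++-assoc s' s w)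

≼-antisym : ∀ {w x} → w ≼ x → x ≼ w → w ≡ x
≼-antisym ([] , refl) _ = refl
≼-antisym {w} (p ∷ s , refl) (s' , e) =
  ⊥-elim (<-irrefl (cong length e) (≤-trans (s≤s (length-++-≤ʳ w {s})) (length-++-≤ʳ (p ∷ s ++ w) {s'})))

⊤ᶠ-lang : ∀ {k} → LSent k ⊤ᶠ
⊤ᶠ-lang = (λ _ → refl) , tt , tt

⊥ᶠ-lang : ∀ {k} → LSent k ⊥ᶠ
⊥ᶠ-lang = (λ _ → refl) , tt

module CanonicalModel (em : ExcludedMiddle 0ℓ) {k₀ : ℕ} (W₀ : World k₀) where
  open World

  level : Node → ℕ
  level w = length w + k₀

  level-mono : ∀ {w x} → w ≼ x → level w ≤ level x
  level-mono {w} (s , refl) = +-monoˡ-≤ k₀ (length-++-≤ʳ w {s})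

  Good : ∀ {k} → World k → Form → Form → Set
  Good {k} W B C = LSent k B × Sentence C × ¬ (theory W ,, B ⊢ᵢ C)

  ⊤-⊬⊥ : ∀ {k} (W : World k) → ¬ (theory W ,, ⊤ᶠ ⊢ᵢ ⊥ᶠ)
  ⊤-⊬⊥ {k} W d = consistent W (closed W (⊥ᶠ-lang {k}) (cut ⊢⊤ d))

  Extension : ∀ {k} → World k → Form → Form → Set₁
  Extension {k} W B C = Σ (World (suc k)) λ W' → theory W ⊆ theory W' × (Good W B C → theory W' B × ¬ theory W' C)

  extension : ∀ {k} (W : World k) B C → Dec (Good W B C) → Extension W B C
  extension W B C (yes (B-lang , C-sent , W,B⊬C)) with lindenbaum em _ (lang W) B-lang C-sent W,B⊬C
  ... | W' , W⊆W' , B∈W' , C∉W' = W' , W⊆W' , λ _ → B∈W' , C∉W'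
  extension {k} W B C (no ¬good) with lindenbaum em k (lang W) (⊤ᶠ-lang {k}) (λ _ → refl) (⊤-⊬⊥ W)
  ... | W' , W⊆W' , _ = W' , W⊆W' , λ good → ⊥-elim (¬good good)

  worldAt : (w : Node) → World (level w)
  worldAt []            = W₀
  worldAt ((B , C) ∷ w) = proj₁ (extension (worldAt w) B C em)

  Th : Node → Pred Form 0ℓ
  Th w = theory (worldAt w)

  Th-mono : ∀ {w x} → w ≼ x → Th w ⊆ Th x
  Th-mono (s , refl) = grow s
    where
    grow : ∀ {w} s → Th w ⊆ Th (s ++ w)
    grow []            h = h
    grow ((B , C) ∷ s) h = proj₁ (proj₂ (extension (worldAt (s ++ _)) B C em)) (grow s h)

  Th-good : ∀ w B C → Good (worldAt w) B C → Th ((B , C) ∷ w) B × ¬ Th ((B , C) ∷ w) C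
  Th-good w B C = proj₂ (proj₂ (extension (worldAt w) B C em))

  name : Elemᶜ → Term
  name d = con (conCode d)

  M : Model
  M = record
    { W         = Node
    ; _≤_       = _≼_
    ; ≤-refl    = ≼-refl
    ; ≤-trans   = ≼-trans
    ; ≤-antisym = ≼-antisym
    ; E         = ℕ
    ; D         = λ w → InLevel (level w)
    ; D-con     = λ _ _ → tt
    ; D-mono    = λ {_} {_} {d} w≼x → InLevel-mono (level-mono w≼x) d
    ; V⁺        = λ w n k ds → All (InLevel (level w)) ds × Th w (pred n k (Vec.map name ds))
    ; V⁻        = λ w n k ds → All (InLevel (level w)) ds × Th w (∼ pred n k (Vec.map name ds))
    ; V⁺-dom    = proj₁
    ; V⁻-dom    = proj₁
    ; V⁺-mono   = λ w≼x (ds∈w , h) → All.map (λ {d} → InLevel-mono (level-mono w≼x) d) ds∈w , Th-mono w≼x h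
    ; V⁻-mono   = λ w≼x (ds∈w , h) → All.map (λ {d} → InLevel-mono (level-mono w≼x) d) ds∈w , Th-mono w≼x h
    }

  open Semantics M using (InDomain; InDomain-mono; InDomain-upd; □-⇔; □∀-⇔; ∃-⇔)

  Th-closed : ∀ w {φ} → LSent (level w) φ → Th w ⊢ᵢ φ → Th w φ
  Th-closed w = closed (worldAt w)

  Th-Axiom-⇔ : ∀ w {φ ψ} → Axiom (φ ⇔ᶠ ψ) → LSent (level w) φ → LSent (level w) ψ → Th w φ ⇔ Th w ψ
  Th-Axiom-⇔ w a φ-lang ψ-lang =
    mk⇔ (λ h → Th-closed w ψ-lang (to (Axiom-⇔ a) (hyp h))) (λ h → Th-closed w φ-lang (from (Axiom-⇔ a) (hyp h)))

  Th-∧ : ∀ w {φ ψ} → LSent (level w) φ → LSent (level w) ψ → (Th w φ × Th w ψ) ⇔ Th w (φ ∧ᶠ ψ)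
  Th-∧ w {φ} {ψ} φ-lang ψ-lang =
    mk⇔ (λ (a , b) → Th-closed w (LSent-∧ {φ = φ} {ψ} φ-lang ψ-lang) (∧-intro (hyp a) (hyp b)))
        (λ h → Th-closed w φ-lang (∧-elimˡ (hyp h)) , Th-closed w ψ-lang (∧-elimʳ (hyp h)))

  Th-∨ : ∀ w {φ ψ} → LSent (level w) φ → LSent (level w) ψ → (Th w φ ⊎ Th w ψ) ⇔ Th w (φ ∨ᶠ ψ)
  Th-∨ w {φ} {ψ} φ-lang ψ-lang =
    mk⇔ [ (λ a → Th-closed w φ∨ψ-lang (mp (hyp a) (ax (ax7 φ ψ))))
        , (λ b → Th-closed w φ∨ψ-lang (mp (hyp b) (ax (ax8 φ ψ)))) ]
        (prime (worldAt w))
    where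
    φ∨ψ-lang : LSent (level w) (φ ∨ᶠ ψ)
    φ∨ψ-lang = LSent-∨ {φ = φ} {ψ} φ-lang ψ-lang

  -- A counterexample to φ ⇒ ψ is the extension by the pair (φ , ψ).
  Th-⇒ : ∀ w {φ ψ} → LSent (level w) φ → LSent (level w) ψ →
         Th w (φ ⇒ ψ) ⇔ (∀ x → w ≼ x → Th x φ → Th x ψ)
  Th-⇒ w {φ} {ψ} φ-lang ψ-lang = mk⇔ forth back
    where
    forth : Th w (φ ⇒ ψ) → ∀ x → w ≼ x → Th x φ → Th x ψ
    forth h x w≼x a = Th-closed x (LSent-mono (level-mono w≼x) ψ ψ-lang) (mp (hyp a) (hyp (Th-mono w≼x h)))
    back : (∀ x → w ≼ x → Th x φ → Th x ψ) → Th w (φ ⇒ ψ)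
    back f with em {Th w (φ ⇒ ψ)}
    ... | yes h = h
    ... | no ¬h = ⊥-elim (ψ∉ (f ((φ , ψ) ∷ w) ((φ , ψ) ∷ [] , refl) φ∈))
      where
      good : Good (worldAt w) φ ψ
      good = φ-lang , proj₁ ψ-lang ,
             λ d → ¬h (Th-closed w (LSent-⇒ {φ = φ} {ψ} φ-lang ψ-lang) (deduction (proj₁ φ-lang) d))
      φ∈ : Th ((φ , ψ) ∷ w) φ
      φ∈ = proj₁ (Th-good w φ ψ good)
      ψ∉ : ¬ Th ((φ , ψ) ∷ w) ψ
      ψ∉ = proj₂ (Th-good w φ ψ good)

  Th-¬ : ∀ w {φ} → LSent (level w) φ → Th w (¬ᶠ φ) ⇔ (∀ x → w ≼ x → ¬ Th x φ)
  Th-¬ w φ-lang = ⇔-trans (Th-⇒ w φ-lang (⊥ᶠ-lang {level w}))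
    (mk⇔ (λ f x w≼x a → consistent (worldAt x) (f x w≼x a)) (λ f x w≼x a → ⊥-elim (f x w≼x a)))

  Th-∃ : ∀ w y X → LSent (level w) (∃ᶠ y X) →
         Th w (∃ᶠ y X) ⇔ (Σ Elemᶜ λ d → InLevel (level w) d × Th w (sub (name d) y X))
  Th-∃ w y X ∃yX-lang = mk⇔ forth back
    where
    forth : Th w (∃ᶠ y X) → Σ Elemᶜ λ d → InLevel (level w) d × Th w (sub (name d) y X)
    forth h with witnessed (worldAt w) h
    ... | c , c∈L , X[c] = conDecode c , c∈L , subst (λ c' → Th w (sub (con c') y X)) (sym (conCode-conDecode c)) X[c]
    back : (Σ Elemᶜ λ d → InLevel (level w) d × Th w (sub (name d) y X)) → Th w (∃ᶠ y X)
    back (d , _ , X[d]) = Th-closed w ∃yX-lang (mp (hyp X[d]) (ax (ax11 X y (name d) (freeFor-con _ y X))))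

  -- A counterexample to ∀y X is the extension by (⊤ , X(c)) for a constant c new at this level.
  Th-∀ : ∀ w y X → LSent (level w) (∀ᶠ y X) →
         Th w (∀ᶠ y X) ⇔ (∀ x → w ≼ x → ∀ d → InLevel (level x) d → Th x (sub (name d) y X))
  Th-∀ w y X (∀yX-sent , X-con) = mk⇔ forth back
    where
    forth : Th w (∀ᶠ y X) → ∀ x → w ≼ x → ∀ d → InLevel (level x) d → Th x (sub (name d) y X)
    forth h x w≼x d d∈x =
      Th-closed x (sentence-sub-con _ y X ∀yX-sent ,
                   AllCon-sub _ y X (InL-conCode _ d d∈x)
                     (AllCon-mono (λ {c} → InLevel-mono (level-mono w≼x) (conDecode c)) X X-con))
        (mp (hyp (Th-mono w≼x h)) (ax (ax14 X y (name d) (freeFor-con _ y X))))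
    back : (∀ x → w ≼ x → ∀ d → InLevel (level x) d → Th x (sub (name d) y X)) → Th w (∀ᶠ y X)
    back f with em {Th w (∀ᶠ y X)}
    ... | yes h = h
    ... | no ¬h = ⊥-elim (X[c]∉ (f _ ((⊤ᶠ , sub (con c) y X) ∷ [] , refl) (inj₂ (pair (level w) 0)) c∈))
      where
      c : Con
      c = newCon (level w) 0
      c∈ : InLevel (suc (level w)) (inj₂ (pair (level w) 0))
      c∈ = subst (λ p → proj₁ p < suc (level w)) (sym (unpair-pair (level w) 0)) ≤-refl
      new : ∀ ψ → AllCon (InL (level w)) ψ → Fresh c ψ
      new = AllCon-mono λ { c∈L refl → newCon-∉ (level w) 0 c∈L }
      good : Good (worldAt w) ⊤ᶠ (sub (con c) y X)
      good = ⊤ᶠ-lang {level w} , sentence-sub-con c y X ∀yX-sent ,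
             λ d → ¬h (Th-closed w (∀yX-sent , X-con)
                        (gen-con c y X (λ {ψ} h → new ψ (proj₂ (lang (worldAt w) h))) (new X X-con) (cut ⊢⊤ d)))
      X[c]∉ : ¬ Th ((⊤ᶠ , sub (con c) y X) ∷ w) (sub (con c) y X)
      X[c]∉ = proj₂ (Th-good w ⊤ᶠ (sub (con c) y X) good)

  Env : Set
  Env = Var → Elemᶜ

  names : Env → Var → Term
  names ρ v = name (ρ v)

  inst-lang : ∀ w ρ → InDomain w ρ → ∀ B → LSent (level w) (inst (names ρ) B)
  inst-lang w ρ ρ∈w B =
    (λ v → notFree-inst v (names ρ) B λ _ → refl) , AllCon-inst (level w) (names ρ) B (λ u → InL-conCode _ (ρ u) (ρ∈w u))

  inst-upd : ∀ B ρ y d → sub (name d) y (inst (updT (names ρ) y (var y)) B) ≡ inst (names (upd M ρ y d)) B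
  inst-upd B ρ y d = trans (sub-inst B _ (name d) y avoids) (inst-cong B pointwise)
    where
    avoids : ∀ v → (v ≡ᵇ y) ≡ false → occT y (updT (names ρ) y (var y) v) ≡ false
    avoids v v≢y rewrite v≢y = refl
    pointwise : ∀ v → subT (name d) y (updT (names ρ) y (var y) v) ≡ names (upd M ρ y d) v
    pointwise v with v ≡ᵇ y
    ... | true rewrite ≡ᵇ-refl y = refl
    ... | false = refl

  evalTs-names : ∀ {n} ρ (ts : Vec Term n) → Vec.map name (Vec.map (evalT M ρ) ts) ≡ instTs (names ρ) ts
  evalTs-names ρ []           = refl
  evalTs-names ρ (var v ∷ ts) = cong (_ ∷_) (evalTs-names ρ ts)
  evalTs-names ρ (con c ∷ ts) = cong (_ ∷_) (evalTs-names ρ ts)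

  evalTs-InLevel : ∀ {n} w ρ → InDomain w ρ → (ts : Vec Term n) → All (InLevel (level w)) (Vec.map (evalT M ρ) ts)
  evalTs-InLevel w ρ ρ∈w []           = []
  evalTs-InLevel w ρ ρ∈w (var v ∷ ts) = ρ∈w v ∷ evalTs-InLevel w ρ ρ∈w ts
  evalTs-InLevel w ρ ρ∈w (con c ∷ ts) = tt ∷ evalTs-InLevel w ρ ρ∈w ts

  Truth : Node → Env → Form → Set
  Truth w ρ B = (I⁺ M w ρ B ⇔ Th w (inst (names ρ) B)) × (I⁻ M w ρ B ⇔ Th w (∼ inst (names ρ) B))

  truth-pred : ∀ w ρ n k ts → InDomain w ρ → Truth w ρ (pred n k ts)
  truth-pred w ρ n k ts ρ∈w =
    mk⇔ (λ (_ , h) → subst (λ us → Th w (pred n k us)) (evalTs-names ρ ts) h)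
        (λ h → evalTs-InLevel w ρ ρ∈w ts , subst (λ us → Th w (pred n k us)) (sym (evalTs-names ρ ts)) h) ,
    mk⇔ (λ (_ , h) → subst (λ us → Th w (∼ pred n k us)) (evalTs-names ρ ts) h)
        (λ h → evalTs-InLevel w ρ ρ∈w ts , subst (λ us → Th w (∼ pred n k us)) (sym (evalTs-names ρ ts)) h)

  truth-⊥ : ∀ w ρ → Truth w ρ ⊥ᶠ
  truth-⊥ w ρ =
    mk⇔ (λ ()) (consistent (worldAt w)) ,
    mk⇔ (λ _ → Th-closed w {∼ ⊥ᶠ} (⊥ᶠ-lang {level w}) (mp ⊢⊤ (ax (ax15 ⊤ᶠ)))) (λ _ → tt)

  module _ (w : Node) (ρ : Env) (ρ∈w : InDomain w ρ) where
    private
      _′ : Form → Form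
      B ′ = inst (names ρ) B
      lang′ : ∀ B → LSent (level w) (B ′)
      lang′ = inst-lang w ρ ρ∈w

    truth-∼ : ∀ B → Truth w ρ B → Truth w ρ (∼ B)
    truth-∼ B (B⁺ , B⁻) = B⁻ , ⇔-trans B⁺ (⇔-sym (Th-Axiom-⇔ w {∼ ∼ B ′} (ax16 (B ′)) (lang′ B) (lang′ B)))

    truth-∧ : ∀ B C → Truth w ρ B → Truth w ρ C → Truth w ρ (B ∧ᶠ C)
    truth-∧ B C (B⁺ , B⁻) (C⁺ , C⁻) =
      ⇔-trans (B⁺ ×-⇔ C⁺) (Th-∧ w (lang′ B) (lang′ C)) ,
      ⇔-trans (B⁻ ⊎-⇔ C⁻) (⇔-trans (Th-∨ w {∼ B ′} {∼ C ′} (lang′ B) (lang′ C))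
        (⇔-sym (Th-Axiom-⇔ w (ax17 (B ′) (C ′)) (lang′ (B ∧ᶠ C))
                             (LSent-∨ {φ = ∼ B ′} {∼ C ′} (lang′ B) (lang′ C)))))

    truth-∨ : ∀ B C → Truth w ρ B → Truth w ρ C → Truth w ρ (B ∨ᶠ C)
    truth-∨ B C (B⁺ , B⁻) (C⁺ , C⁻) =
      ⇔-trans (B⁺ ⊎-⇔ C⁺) (Th-∨ w (lang′ B) (lang′ C)) ,
      ⇔-trans (B⁻ ×-⇔ C⁻) (⇔-trans (Th-∧ w {∼ B ′} {∼ C ′} (lang′ B) (lang′ C))
        (⇔-sym (Th-Axiom-⇔ w (ax18 (B ′) (C ′)) (lang′ (B ∨ᶠ C))
                             (LSent-∧ {φ = ∼ B ′} {∼ C ′} (lang′ B) (lang′ C)))))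

    truth-⇒ : ∀ B C → (∀ x → w ≼ x → Truth x ρ B) → (∀ x → w ≼ x → Truth x ρ C) → Truth w ρ (B ⇒ C)
    truth-⇒ B C IH-B IH-C =
      ⇔-trans (□-⇔ λ x w≼x → ⇔-trans (¬-cong-⇔ (proj₁ (IH-B x w≼x)) ⊎-⇔ proj₁ (IH-C x w≼x)) (¬⊎⇔→ em))
              (⇔-sym (Th-⇒ w (lang′ B) (lang′ C))) ,
      ⇔-trans ((□-⇔ λ x w≼x → ¬-cong-⇔ (proj₂ (IH-B x w≼x))) ×-⇔ proj₂ (IH-C w ≼-refl))
        (⇔-trans (⇔-sym (Th-¬ w {∼ B ′} (lang′ B)) ×-⇔ ⇔-id _)
          (⇔-trans (Th-∧ w {¬ᶠ (∼ B ′)} {∼ C ′} ¬∼B-lang (lang′ C))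
            (⇔-sym (Th-Axiom-⇔ w (ax19 (B ′) (C ′)) (lang′ (B ⇒ C))
                                 (LSent-∧ {φ = ¬ᶠ (∼ B ′)} {∼ C ′} ¬∼B-lang (lang′ C))))))
      where
      ¬∼B-lang : LSent (level w) (¬ᶠ (∼ B ′))
      ¬∼B-lang = LSent-⇒ {φ = ∼ B ′} {⊥ᶠ} (lang′ B) (⊥ᶠ-lang {level w})

  module _ (w : Node) (ρ : Env) (ρ∈w : InDomain w ρ) (y : Var) (B : Form) where
    private
      X : Form
      X = inst (updT (names ρ) y (var y)) B
      X-lang : LSent (level w) (∀ᶠ y X)
      X-lang = inst-lang w ρ ρ∈w (∀ᶠ y B)
      instance-⇔ : ∀ x d {P : Set} → P ⇔ Th x (inst (names (upd M ρ y d)) B) → P ⇔ Th x (sub (name d) y X)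
      instance-⇔ x d = subst (λ F → _ ⇔ Th x F) (sym (inst-upd B ρ y d))
      ∼instance-⇔ : ∀ x d {P : Set} → P ⇔ Th x (∼ inst (names (upd M ρ y d)) B) → P ⇔ Th x (∼ sub (name d) y X)
      ∼instance-⇔ x d = subst (λ F → _ ⇔ Th x (∼ F)) (sym (inst-upd B ρ y d))

    truth-∀ : (∀ x → w ≼ x → ∀ d → InLevel (level x) d → Truth x (upd M ρ y d) B) → Truth w ρ (∀ᶠ y B)
    truth-∀ IH =
      ⇔-trans (□∀-⇔ λ x w≼x d d∈x → instance-⇔ x d (proj₁ (IH x w≼x d d∈x))) (⇔-sym (Th-∀ w y X X-lang)) ,
      ⇔-trans (∃-⇔ {w} λ d d∈w → ∼instance-⇔ w d (proj₂ (IH w ≼-refl d d∈w)))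
        (⇔-trans (⇔-sym (Th-∃ w y (∼ X) X-lang)) (⇔-sym (Th-Axiom-⇔ w (ax20 X y) X-lang X-lang)))

    truth-∃ : (∀ x → w ≼ x → ∀ d → InLevel (level x) d → Truth x (upd M ρ y d) B) → Truth w ρ (∃ᶠ y B)
    truth-∃ IH =
      ⇔-trans (∃-⇔ {w} λ d d∈w → instance-⇔ w d (proj₁ (IH w ≼-refl d d∈w))) (⇔-sym (Th-∃ w y X X-lang)) ,
      ⇔-trans (□∀-⇔ λ x w≼x d d∈x → ∼instance-⇔ x d (proj₂ (IH x w≼x d d∈x)))
        (⇔-trans (⇔-sym (Th-∀ w y (∼ X) X-lang)) (⇔-sym (Th-Axiom-⇔ w (ax21 X y) X-lang X-lang)))

  truth : ∀ B w ρ → InDomain w ρ → Truth w ρ B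
  truth (pred n k ts) w ρ ρ∈w = truth-pred w ρ n k ts ρ∈w
  truth ⊥ᶠ       w ρ ρ∈w = truth-⊥ w ρ
  truth (∼ B)    w ρ ρ∈w = truth-∼ w ρ ρ∈w B (truth B w ρ ρ∈w)
  truth (B ∧ᶠ C) w ρ ρ∈w = truth-∧ w ρ ρ∈w B C (truth B w ρ ρ∈w) (truth C w ρ ρ∈w)
  truth (B ∨ᶠ C) w ρ ρ∈w = truth-∨ w ρ ρ∈w B C (truth B w ρ ρ∈w) (truth C w ρ ρ∈w)
  truth (B ⇒ C)  w ρ ρ∈w = truth-⇒ w ρ ρ∈w B C (λ x w≼x → truth B x ρ (InDomain-mono w≼x ρ∈w))
                                                (λ x w≼x → truth C x ρ (InDomain-mono w≼x ρ∈w))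
  truth (∀ᶠ y B) w ρ ρ∈w = truth-∀ w ρ ρ∈w y B λ x w≼x d d∈x →
    truth B x _ (InDomain-upd {x} y d (InDomain-mono w≼x ρ∈w) d∈x)
  truth (∃ᶠ y B) w ρ ρ∈w = truth-∃ w ρ ρ∈w y B λ x w≼x d d∈x →
    truth B x _ (InDomain-upd {x} y d (InDomain-mono w≼x ρ∈w) d∈x)

sound : ExcludedMiddle 0ℓ → ∀ {Γ A} → (∀ B → Γ B → Sentence B) → Γ ⊢ᵢ A → Γ ⊨ᵢ A
sound em Γ-sent Γ⊢A M w Γ-true =
  soundness Γ⊢A w _ (λ _ → D-con w 0) λ {B} B∈Γ → sentence-persistent B (Γ-sent B B∈Γ) (Γ-true B B∈Γ)
  where
  open Model M using (D-con)
  open Semantics M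
  open Soundness em

complete : ExcludedMiddle 0ℓ → ∀ {Γ A} → (∀ B → Γ B → Sentence B) → Sentence A → Γ ⊨ᵢ A → Γ ⊢ᵢ A
complete em {Γ} {A} Γ-sent A-sent Γ⊨A with em {Γ ⊢ᵢ A}
... | yes Γ⊢A = Γ⊢A
... | no  Γ⊬A = ⊥-elim (A₀∉W₀ (to (proj₁ (truth A [] ρ₀ λ _ → tt)) (Γ⊨A M [] Γ-true)))
  where
  σ₀ : Var → Term
  σ₀ _ = con 0

  rename-back : ∀ B → Sentence B → csub (con ∘ half) (inst σ₀ B) ≡ B
  rename-back B B-sent = trans (cong (csub (con ∘ half)) (inst-id σ₀ B λ v v∈B → ⊥-elim (sentence-closed {B} B-sent v v∈B)))
                               (csub-inverse half double half-double B)

  inst₀-lang : ∀ B → LSent 0 (inst σ₀ B)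
  inst₀-lang B = (λ v → notFree-inst v σ₀ B λ _ → refl) , AllCon-inst 0 σ₀ B λ _ → InL-double 0 0

  Γ₀ : Pred Form 0ℓ
  Γ₀ φ = Σ Form λ B → Γ B × φ ≡ inst σ₀ B

  Γ₀-lang : ∀ {φ} → Γ₀ φ → LSent 0 φ
  Γ₀-lang (B , _ , refl) = inst₀-lang B

  Γ₀,⊤⊬A₀ : ¬ (Γ₀ ,, ⊤ᶠ ⊢ᵢ inst σ₀ A)
  Γ₀,⊤⊬A₀ d =
    Γ⊬A (subst (Γ ⊢ᵢ_) (rename-back A A-sent) (cut ⊢⊤ (csub-⊢ (con ∘ half) d (λ _ _ _ → refl) back)))
    where
    back : ∀ {ψ} → (Γ₀ ,, ⊤ᶠ) ψ → (Γ ,, ⊤ᶠ) (csub (con ∘ half) ψ)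
    back (inj₁ (B , B∈Γ , refl)) = inj₁ (subst Γ (sym (rename-back B (Γ-sent B B∈Γ))) B∈Γ)
    back (inj₂ refl)             = inj₂ refl

  root : Σ (World 1) λ W → Γ₀ ⊆ World.theory W × World.theory W ⊤ᶠ × ¬ World.theory W (inst σ₀ A)
  root = lindenbaum em 0 Γ₀-lang (⊤ᶠ-lang {0}) (proj₁ (inst₀-lang A)) Γ₀,⊤⊬A₀
  open CanonicalModel em (proj₁ root)

  ρ₀ : Var → Elemᶜ
  ρ₀ _ = inj₁ 0

  A₀∉W₀ : ¬ Th [] (inst σ₀ A)
  A₀∉W₀ = proj₂ (proj₂ (proj₂ root))

  Γ-true : ∀ B → Γ B → true⁺ M [] B
  Γ-true B B∈Γ = from (proj₁ (truth B [] ρ₀ λ _ → tt)) (proj₁ (proj₂ root) (B , B∈Γ , refl))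

theorem4p5 : ExcludedMiddle 0ℓ →
    (Γ : Form → Set) (A : Form) →
    (∀ B → Γ B → Sentence B) → Sentence A →
    (Γ ⊢ᵢ A) ⇔ (Γ ⊨ᵢ A)
theorem4p5 em Γ A Γ-sent A-sent = mk⇔ (sound em Γ-sent) (complete em Γ-sent A-sent)
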